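{- Let $\mathcal L$ be a FOLeq algebra over a termlike $\sigma$-algebra $\mathsf U$ and let $\mathcal I$ be an interpretation of a signature $(\Sigma,\Pi,\mathrm{ar})$ over $\mathcal L$. If the sequent $\Phi\vdash\Psi$ is derivable, then $\bigwedge\{[\![\phi]\!]\mid \phi\in\Phi\}\leq\bigvee\{[\![\psi]\!]\mid\psi\in\Psi\}$ in $\mathcal L$.
   Context: Nominal sets: fix a countably infinite set $\mathbb A$ of atoms; $a,b,c$ denote distinct atoms. A permutation is a bijection $\pi$ of $\mathbb A$ moving finitely many atoms; $(a\ b)$ is the swapping. A set with a permutation action is a set with a group action $\pi\cdot x$ of permutations; $A\subseteq\mathbb A$ supports $x$ if $\pi\cdot x=x$ whenever $\pi$ fixes $A$ pointwise; a nominal set is one where every element has a finite supporting set, and $\mathrm{supp}(x)$ is the least such; $a\#x$ means $a\notin\mathrm{supp}(x)$. A map is equivariant if $\pi\cdot f(x)=f(\pi\cdot x)$. $\mathbb A$ carries $\pi\cdot a=\pi(a)$; products act pointwise. $\mathsf N a.\,\Phi(a)$ means $\{a\mid\neg\Phi(a)\}$ is finite. Termlike $\sigma$-algebra $\mathsf U$: a nominal set with equivariant $(x,a,u)\mapsto x[a:=u]$ ($\mathsf U\times\mathbb A\times\mathsf U\to\mathsf U$) and an equivariant injection $\mathrm{atm}:\mathbb A\to\mathsf U$ (written $a$), satisfying: $a[a:=x]=x$; $x[a:=a]=x$; $a\#x\Rightarrow x[a:=u]=x$; $b\#x\Rightarrow x[a:=u]=((b\ a)\cdot x)[b:=u]$;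 $a\#v\Rightarrow x[a:=u][b:=v]=x[b:=v][a:=u[b:=v]]$. A $\sigma$-algebra over $\mathsf U$ is a nominal set $X$ with equivariant $X\times\mathbb A\times\mathsf U\to X$, $x[a:=u]$, satisfying the last four axioms (with $x\in X$, $u,v\in\mathsf U$). Simultaneous substitution: $x[a_1:=u_1,\dots,a_n:=u_n]=(((a_1'\ a_1)\circ\cdots\circ(a_n'\ a_n))\cdot x)[a_1':=u_1]\cdots[a_n':=u_n]$ for fresh distinct $a_i'$. Nominal poset: nominal set with equivariant partial order $\leq$. For finite $X\subseteq\mathcal L$, finite $A\subseteq\mathbb A$, the $A\#$limit $\bigwedge^{\#A}X$ is the greatest element of $\{x'\mid A\cap\mathrm{supp}(x')=\emptyset,\ x'\leq x\ \forall x\in X\}$; $A\#$colimit $\bigvee^{\#A}X$ dually (least $A$-fresh upper bound). Finitely fresh-(co)complete: all these exist. $\top,\bot,x\wedge y,x\vee y$ are the ordinary (co)limits of $\emptyset,\{x,y\}$; $\bigwedge^{\#a}x=\bigwedge^{\#\{a\}}\{x\}$. Complemented: every $x$ has $\neg x$ with $x\wedge\neg x=\bot$, $x\vee\neg x=\top$. Distributive: $x\vee(y\wedge z)=(x\vee y)\wedge(x\vee z)$ and $a\#x\Rightarrow x\vee\bigwedge^{\#a}y=\bigwedge^{\#a}(x\vee y)$. A $\sigma$-algebra structure over $\mathsf U$ on $\mathcal L$ is compatible if, whenever $A\cap(\mathrm{supp}(u)\cup\{a\})=\emptyset$, $(\bigwedge^{\#A}X)[a:=u]=\bigwedge^{\#A}\{x[a:=u]\mid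 x\in X\}$ and likewise for $\bigvee^{\#A}$, and $(\neg x)[a:=u]=\neg(x[a:=u])$. An equality is an element $(a=^{\mathcal L}b)$ with support in $\{a,b\}$ such that $(a=^{\mathcal L}b)[a:=u,b:=u]=\top$ and $(a=^{\mathcal L}b)[a:=u,b:=v]\wedge z[a:=u]=(a=^{\mathcal L}b)[a:=u,b:=v]\wedge z[a:=v]$ for all $u,v\in\mathsf U$, $z\in\mathcal L$. A FOLeq algebra over $\mathsf U$ is a finitely fresh-complete and fresh-cocomplete, distributive, complemented nominal poset with a compatible $\sigma$-algebra structure over $\mathsf U$ and an equality. Syntax: a signature gives function symbols $\mathsf f$ and predicate symbols $\mathsf P$ with arities. Terms $r::=a\mid \mathsf f(r_1,\dots,r_n)$; predicates $\phi::=\bot\mid r=r\mid\mathsf P(r_1,\dots,r_n)\mid\phi\wedge\phi\mid\neg\phi\mid\forall a.\phi$, taken up to $\alpha$-equivalence with capture-avoiding substitution; $\phi\vee\psi$ abbreviates $\neg(\neg\phi\wedge\neg\psi)$. Derivable sequents $\Phi\vdash\Psi$ (finite sets) are generated by the classical sequent rules: Hyp ($\Phi,\phi\vdash\phi,\Psi$), $\bot$L, $\wedge$L, $\wedge$R, $\neg$L, $\neg$R; $\forall$L: from $\Phi,\phi[a:=r]\vdash\Psi$ infer $\Phi,\forall a.\phi\vdash\Psi$; $\forall$R: from $\Phi\vdash\psi,\Psi$ with $a$ not free in $\Phi,\Psi$ infer $\Phi\vdash\forall a.\psi,\Psi$; $=$R: from $\Phi,r=r\vdash\Psi$ infer $\Phi\vdash\Psi$;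 $=$L: from $\Phi,r'=r,\phi[a:=r']\vdash\Psi$ infer $\Phi,r'=r,\phi[a:=r]\vdash\Psi$. Interpretation: assigns to each $n$-ary $\mathsf f$ an equivariant map $\mathsf f^{\mathcal I}$ from $n$-tuples of distinct atoms to $\mathsf U$, and to each $n$-ary $\mathsf P$ an equivariant map $\mathsf P^{\mathcal I}$ from $n$-tuples of distinct atoms to $\mathcal L$; extended by $\mathsf f^{\mathcal I}(u_1,..,u_n)=\mathsf f^{\mathcal I}(a_1,..,a_n)[a_1:=u_1,..,a_n:=u_n]$ (fresh $a_i$), likewise $\mathsf P^{\mathcal I}$, and $u_1=^{\mathcal I}u_2=(a=^{\mathcal L}b)[a:=u_1,b:=u_2]$. Then $[\![a]\!]=\mathrm{atm}(a)$, $[\![\mathsf f(\vec r)]\!]=\mathsf f^{\mathcal I}([\![\vec r]\!])$, $[\![\bot]\!]=\bot$, $[\![r=s]\!]=[\![r]\!]=^{\mathcal I}[\![s]\!]$, $[\![\mathsf P(\vec r)]\!]=\mathsf P^{\mathcal I}([\![\vec r]\!])$, $[\![\phi\wedge\psi]\!]=[\![\phi]\!]\wedge[\![\psi]\!]$, $[\![\neg\phi]\!]=\neg[\![\phi]\!]$, $[\![\forall a.\phi]\!]=\bigwedge^{\#a}[\![\phi]\!]$. -}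

module Defs where

open import Data.Nat using (ℕ; zero; suc; _+_; _⊔_)
open import Data.Nat.Properties using (_≟_; +-cancelˡ-≡)
open import Data.Fin using (Fin; zero; suc; toℕ; fromℕ; inject₁)
open import Data.Fin.Properties using (toℕ-injective)
open import Data.Product using (Σ; _×_; _,_; proj₁; proj₂)
open import Data.List using (List; []; _∷_; _++_; map; foldr; foldl; concatMap)
open import Data.List.Membership.Propositional using (_∈_; _∉_)
open import Data.List.Membership.Propositional.Properties using (∈-++⁺ˡ; ∈-++⁺ʳ)
open import Data.List.Relation.Unary.Any using (here; there)
import Data.Vec as V
open import Data.Vec using (Vec)
open import Data.Vec.Properties using (lookup∘tabulate)
open import Data.Empty using (⊥-elim)
open import Relation.Nullary using (yes; no; Dec)
open import Relation.Binary.PropositionalEquality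
  using (_≡_; _≢_; refl; sym; trans; cong)

-- Atoms and (finitely supported) permutations

Atom : Set
Atom = ℕ

swapA : Atom → Atom → Atom → Atom
swapA a b c with c ≟ a
... | yes _ = b
... | no _ with c ≟ b
...   | yes _ = a
...   | no _ = c

swapA-a : ∀ a b → swapA a b a ≡ b
swapA-a a b with a ≟ a
... | yes _ = refl
... | no ¬p = ⊥-elim (¬p refl)

swapA-b : ∀ a b → swapA a b b ≡ a
swapA-b a b with b ≟ a
... | yes p = p
... | no _ with b ≟ b
...   | yes _ = refl
...   | no ¬q = ⊥-elim (¬q refl)

swapA-other : ∀ a b c → c ≢ a → c ≢ b → swapA a b c ≡ c
swapA-other a b c ¬ca ¬cb with c ≟ a
... | yes p = ⊥-elim (¬ca p)
... | no _ with c ≟ b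
...   | yes q = ⊥-elim (¬cb q)
...   | no _ = refl

swapA-invol-aux : ∀ a b c → Dec (c ≡ a) → Dec (c ≡ b) →
                  swapA a b (swapA a b c) ≡ c
swapA-invol-aux a b c (yes refl) _ =
  trans (cong (swapA a b) (swapA-a a b)) (swapA-b a b)
swapA-invol-aux a b c (no _) (yes refl) =
  trans (cong (swapA a b) (swapA-b a b)) (swapA-a a b)
swapA-invol-aux a b c (no ¬ca) (no ¬cb) =
  trans (cong (swapA a b) (swapA-other a b c ¬ca ¬cb)) (swapA-other a b c ¬ca ¬cb)

swapA-invol : ∀ a b c → swapA a b (swapA a b c) ≡ c
swapA-invol a b c = swapA-invol-aux a b c (c ≟ a) (c ≟ b)

record Perm : Set where
  field
    to        : Atom → Atom
    from      : Atom → Atom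
    to-from   : ∀ a → to (from a) ≡ a
    from-to   : ∀ a → from (to a) ≡ a
    dom       : List Atom
    fixes-out : ∀ a → a ∉ dom → to a ≡ a

open Perm public using (to)

idP : Perm
idP = record { to = λ a → a ; from = λ a → a ; to-from = λ _ → refl
             ; from-to = λ _ → refl ; dom = [] ; fixes-out = λ _ _ → refl }

_∘P_ : Perm → Perm → Perm
π ∘P σ = record
  { to = λ a → Perm.to π (Perm.to σ a)
  ; from = λ a → Perm.from σ (Perm.from π a)
  ; to-from = λ a → trans (cong (Perm.to π) (Perm.to-from σ (Perm.from π a)))
                          (Perm.to-from π a)
  ; from-to = λ a → trans (cong (Perm.from σ) (Perm.from-to π (Perm.to σ a)))
                          (Perm.from-to σ a)
  ; dom = Perm.dom π ++ Perm.dom σ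
  ; fixes-out = λ a a∉ →
      trans (cong (Perm.to π)
                  (Perm.fixes-out σ a (λ a∈ → a∉ (∈-++⁺ʳ (Perm.dom π) a∈))))
            (Perm.fixes-out π a (λ a∈ → a∉ (∈-++⁺ˡ a∈)))
  }

swapP : Atom → Atom → Perm
swapP a b = record
  { to = swapA a b ; from = swapA a b
  ; to-from = swapA-invol a b ; from-to = swapA-invol a b
  ; dom = a ∷ b ∷ []
  ; fixes-out = λ c c∉ → swapA-other a b c (λ e → c∉ (here e))
                                           (λ e → c∉ (there (here e)))
  }

-- Nominal sets

Supports : {X : Set} → (Perm → X → X) → List Atom → X → Set
Supports act A x = ∀ π → (∀ a → a ∈ A → to π a ≡ a) → act π x ≡ x

record NominalSet : Set₁ where
  field
    Carrier : Set
    -- a group action of permutations (permutations that agree as functions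
    -- on atoms are the same permutation, hence act identically)
    act     : Perm → Carrier → Carrier
    act-id  : ∀ x → act idP x ≡ x
    act-∘   : ∀ π σ x → act (π ∘P σ) x ≡ act π (act σ x)
    act-ext : ∀ π σ → (∀ a → to π a ≡ to σ a) → ∀ x → act π x ≡ act σ x
    finSupp : ∀ x → Σ (List Atom) (λ A → Supports act A x)

  suppL : Carrier → List Atom
  suppL x = proj₁ (finSupp x)

  -- freshness: a ∉ supp(x), i.e. some finite support of x avoids a
  -- (supp(x) is the least finite support)
  _#_ : Atom → Carrier → Set
  a # x = Σ (List Atom) (λ A → Supports act A x × a ∉ A)

open NominalSet public using (Carrier)

maxL : List ℕ → ℕ
maxL = foldr _⊔_ 0

-- σ-algebras

record IsSigmaAlg (UN : NominalSet) (atm : Atom → Carrier UN)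
                  (subU : Carrier UN → Atom → Carrier UN → Carrier UN)
                  (X : NominalSet)
                  (sub : Carrier X → Atom → Carrier UN → Carrier X) : Set where
  private
    module U = NominalSet UN
    module X = NominalSet X
  field
    sub-eqv  : ∀ π x a u →
               X.act π (sub x a u) ≡ sub (X.act π x) (to π a) (U.act π u)
    σ-id     : ∀ x a → sub x a (atm a) ≡ x
    σ-#      : ∀ x a u → a X.# x → sub x a u ≡ x
    σ-α      : ∀ x a b u → a ≢ b → b X.# x →
               sub x a u ≡ sub (X.act (swapP b a) x) b u
    σ-σ      : ∀ x a b u v → a ≢ b → a U.# v →
               sub (sub x a u) b v ≡ sub (sub x b v) a (subU u b v)

record Termlike : Set₁ where
  field
    UN      : NominalSet
  open NominalSet UN public renaming (Carrier to U)
  field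
    subU    : U → Atom → U → U
    atm     : Atom → U
    atm-eqv : ∀ π a → act π (atm a) ≡ atm (to π a)
    atm-inj : ∀ a b → atm a ≡ atm b → a ≡ b
    σ-atm   : ∀ a x → subU (atm a) a x ≡ x
    isσ     : IsSigmaAlg UN atm subU UN subU

-- Simultaneous substitution
-- x[a₁:=u₁,…,aₙ:=uₙ] = (((a₁' a₁)∘⋯∘(aₙ' aₙ))·x)[a₁':=u₁]⋯[aₙ':=uₙ]
-- for fresh distinct aᵢ'; here aᵢ' = suc m + (i-1) where m bounds a finite
-- support of x, all aᵢ, and finite supports of all uᵢ.

module SimSubst (UN : NominalSet) (X : NominalSet)
                (sub : Carrier X → Atom → Carrier UN → Carrier X) where
  private
    module U = NominalSet UN
    module X = NominalSet X

  renameFrom : Atom → List (Atom × Carrier UN) → Perm × List (Atom × Carrier UN)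
  renameFrom k [] = idP , []
  renameFrom k ((a , u) ∷ ps) with renameFrom (suc k) ps
  ... | π , qs = (swapP k a ∘P π) , ((k , u) ∷ qs)

  simSubst : Carrier X → List (Atom × Carrier UN) → Carrier X
  simSubst x ps =
    let m = maxL (X.suppL x ++ map proj₁ ps ++ concatMap (λ p → U.suppL (proj₂ p)) ps)
        r = renameFrom (suc m) ps
    in foldl (λ y q → sub y (proj₁ q) (proj₂ q)) (X.act (proj₁ r) x) (proj₂ r)

-- FOLeq algebras

record FOLeq (T : Termlike) : Set₁ where
  open Termlike T using (UN; U; subU; atm) renaming (_#_ to _#U_)
  field
    LN : NominalSet
  open NominalSet LN public renaming (Carrier to L)
  field
    _≤_       : L → L → Set
    ≤-refl    : ∀ x → x ≤ x
    ≤-trans   : ∀ x y z → x ≤ y → y ≤ z → x ≤ z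
    ≤-antisym : ∀ x y → x ≤ y → y ≤ x → x ≡ y
    ≤-eqv     : ∀ π x y → x ≤ y → act π x ≤ act π y
    meet#       : List Atom → List L → L
    meet#-fresh : ∀ A X a → a ∈ A → a # meet# A X
    meet#-lb    : ∀ A X x → x ∈ X → meet# A X ≤ x
    meet#-great : ∀ A X y → (∀ a → a ∈ A → a # y) → (∀ x → x ∈ X → y ≤ x) →
                  y ≤ meet# A X
    join#       : List Atom → List L → L
    join#-fresh : ∀ A X a → a ∈ A → a # join# A X
    join#-ub    : ∀ A X x → x ∈ X → x ≤ join# A X
    join#-least : ∀ A X y → (∀ a → a ∈ A → a # y) → (∀ x → x ∈ X → x ≤ y) →
                  join# A X ≤ y

  ⊤ : L
  ⊤ = meet# [] []
  ⊥ : L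
  ⊥ = join# [] []
  _∧_ : L → L → L
  x ∧ y = meet# [] (x ∷ y ∷ [])
  _∨_ : L → L → L
  x ∨ y = join# [] (x ∷ y ∷ [])

  field
    ¬_       : L → L
    ∧-compl  : ∀ x → x ∧ (¬ x) ≡ ⊥
    ∨-compl  : ∀ x → x ∨ (¬ x) ≡ ⊤
    distrib  : ∀ x y z → x ∨ (y ∧ z) ≡ (x ∨ y) ∧ (x ∨ z)
    distrib# : ∀ x y a → a # x →
               x ∨ meet# (a ∷ []) (y ∷ []) ≡ meet# (a ∷ []) ((x ∨ y) ∷ [])
    subL     : L → Atom → U → L
    isσL     : IsSigmaAlg UN atm subU LN subL
    compat-meet : ∀ A X a u → (∀ c → c ∈ A → (c #U u) × (c ≢ a)) →
                  subL (meet# A X) a u ≡ meet# A (map (λ x → subL x a u) X)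
    compat-join : ∀ A X a u → (∀ c → c ∈ A → (c #U u) × (c ≢ a)) →
                  subL (join# A X) a u ≡ join# A (map (λ x → subL x a u) X)
    compat-¬    : ∀ x a u → subL (¬ x) a u ≡ ¬ (subL x a u)

  open SimSubst UN LN subL public

  field
    -- an equality (a =^L b), for two distinct atoms a = eqA, b = eqB
    eqA eqB   : Atom
    eqA≢eqB   : eqA ≢ eqB
    eqL       : L
    eqL-supp  : Supports act (eqA ∷ eqB ∷ []) eqL
    eqL-refl  : ∀ u → simSubst eqL ((eqA , u) ∷ (eqB , u) ∷ []) ≡ ⊤
    eqL-subst : ∀ u v z →
                simSubst eqL ((eqA , u) ∷ (eqB , v) ∷ []) ∧ subL z eqA u
                ≡ simSubst eqL ((eqA , u) ∷ (eqB , v) ∷ []) ∧ subL z eqA v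

-- Syntax

record Signature : Set₁ where
  field
    Fun  : Set
    Pred : Set
    arF  : Fun → ℕ
    arP  : Pred → ℕ

-- Terms and predicates up to α-equivalence, represented in the
-- locally nameless style: free variables are atoms, bound variables are
-- de Bruijn indices (Fin n, 0 = innermost binder); Term 0 / Form 0 are the
-- terms / predicates of the paper.
module Syntax (S : Signature) where
  open Signature S

  data Term (n : ℕ) : Set where
    bvar : Fin n → Term n
    fvar : Atom → Term n
    app  : (f : Fun) → Vec (Term n) (arF f) → Term n

  data Form (n : ℕ) : Set where
    ⊥f   : Form n
    _≐_  : Term n → Term n → Form n
    pred : (P : Pred) → Vec (Term n) (arP P) → Form n
    _∧f_ : Form n → Form n → Form n
    ¬f   : Form n → Form n
    ∀f   : Form (suc n) → Form n

  mutual
    fvT : ∀ {n} → Term n → List Atom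
    fvT (bvar _) = []
    fvT (fvar a) = a ∷ []
    fvT (app f ts) = fvTs ts

    fvTs : ∀ {n k} → Vec (Term n) k → List Atom
    fvTs V.[] = []
    fvTs (t V.∷ ts) = fvT t ++ fvTs ts

  fvF : ∀ {n} → Form n → List Atom
  fvF ⊥f = []
  fvF (r ≐ s) = fvT r ++ fvT s
  fvF (pred P ts) = fvTs ts
  fvF (φ ∧f ψ) = fvF φ ++ fvF ψ
  fvF (¬f φ) = fvF φ
  fvF (∀f φ) = fvF φ

  fvFs : List (Form 0) → List Atom
  fvFs = concatMap fvF

  mutual
    wk : ∀ {n} → Term 0 → Term n
    wk (bvar ())
    wk (fvar a) = fvar a
    wk (app f ts) = app f (wks ts)

    wks : ∀ {n k} → Vec (Term 0) k → Vec (Term n) k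
    wks V.[] = V.[]
    wks (t V.∷ ts) = wk t V.∷ wks ts

  mutual
    substT : ∀ {n} → Term n → Atom → Term 0 → Term n
    substT (bvar i) a r = bvar i
    substT (fvar b) a r with b ≟ a
    ... | yes _ = wk r
    ... | no _  = fvar b
    substT (app f ts) a r = app f (substTs ts a r)

    substTs : ∀ {n k} → Vec (Term n) k → Atom → Term 0 → Vec (Term n) k
    substTs V.[] a r = V.[]
    substTs (t V.∷ ts) a r = substT t a r V.∷ substTs ts a r

  substF : ∀ {n} → Form n → Atom → Term 0 → Form n
  substF ⊥f a r = ⊥f
  substF (s ≐ t) a r = substT s a r ≐ substT t a r
  substF (pred P ts) a r = pred P (substTs ts a r)
  substF (φ ∧f ψ) a r = substF φ a r ∧f substF ψ a r
  substF (¬f φ) a r = ¬f (substF φ a r)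
  substF (∀f φ) a r = ∀f (substF φ a r)

  -- abstraction of the atom a (turning it into the outermost bound variable)
  mutual
    absT : ∀ {n} → Atom → Term n → Term (suc n)
    absT {n} a (bvar i) = bvar (inject₁ i)
    absT {n} a (fvar b) with b ≟ a
    ... | yes _ = bvar (fromℕ n)
    ... | no _  = fvar b
    absT a (app f ts) = app f (absTs a ts)

    absTs : ∀ {n k} → Atom → Vec (Term n) k → Vec (Term (suc n)) k
    absTs a V.[] = V.[]
    absTs a (t V.∷ ts) = absT a t V.∷ absTs a ts

  absF : ∀ {n} → Atom → Form n → Form (suc n)
  absF a ⊥f = ⊥f
  absF a (s ≐ t) = absT a s ≐ absT a t
  absF a (pred P ts) = pred P (absTs a ts)
  absF a (φ ∧f ψ) = absF a φ ∧f absF a ψ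
  absF a (¬f φ) = ¬f (absF a φ)
  absF a (∀f φ) = ∀f (absF a φ)

  all : Atom → Form 0 → Form 0
  all a φ = ∀f (absF a φ)

  -- finite sets of predicates are represented by lists up to having the
  -- same elements
  SameSet : List (Form 0) → List (Form 0) → Set
  SameSet Φ Φ' = ∀ φ → (φ ∈ Φ → φ ∈ Φ') × (φ ∈ Φ' → φ ∈ Φ)

  -- derivable sequents (Φ, φ is the set Φ ∪ {φ}, represented by φ ∷ Φ)
  infix 4 _⊢_
  data _⊢_ : List (Form 0) → List (Form 0) → Set where
    set-conv : ∀ {Φ Φ' Ψ Ψ'} → SameSet Φ Φ' → SameSet Ψ Ψ' → Φ ⊢ Ψ → Φ' ⊢ Ψ'
    Hyp  : ∀ {Φ Ψ φ} → φ ∷ Φ ⊢ φ ∷ Ψ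
    ⊥L   : ∀ {Φ Ψ} → ⊥f ∷ Φ ⊢ Ψ
    ∧L   : ∀ {Φ Ψ φ ψ} → φ ∷ ψ ∷ Φ ⊢ Ψ → (φ ∧f ψ) ∷ Φ ⊢ Ψ
    ∧R   : ∀ {Φ Ψ φ ψ} → Φ ⊢ φ ∷ Ψ → Φ ⊢ ψ ∷ Ψ → Φ ⊢ (φ ∧f ψ) ∷ Ψ
    ¬L   : ∀ {Φ Ψ φ} → Φ ⊢ φ ∷ Ψ → ¬f φ ∷ Φ ⊢ Ψ
    ¬R   : ∀ {Φ Ψ φ} → φ ∷ Φ ⊢ Ψ → Φ ⊢ ¬f φ ∷ Ψ
    ∀L   : ∀ {Φ Ψ φ a r} → substF φ a r ∷ Φ ⊢ Ψ → all a φ ∷ Φ ⊢ Ψ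
    ∀R   : ∀ {Φ Ψ ψ a} → a ∉ fvFs Φ → a ∉ fvFs Ψ →
           Φ ⊢ ψ ∷ Ψ → Φ ⊢ all a ψ ∷ Ψ
    =R   : ∀ {Φ Ψ r} → (r ≐ r) ∷ Φ ⊢ Ψ → Φ ⊢ Ψ
    =L   : ∀ {Φ Ψ φ a r r'} → (r' ≐ r) ∷ substF φ a r' ∷ Φ ⊢ Ψ →
           (r' ≐ r) ∷ substF φ a r ∷ Φ ⊢ Ψ

-- Interpretations and semantics

Distinct : ∀ {n} → Vec Atom n → Set
Distinct as = ∀ i j → V.lookup as i ≡ V.lookup as j → i ≡ j

freshVec : ∀ n → ℕ → Vec Atom n
freshVec n m = V.tabulate (λ i → suc m + toℕ i)

freshVec-distinct : ∀ n m → Distinct (freshVec n m)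
freshVec-distinct n m i j e =
  toℕ-injective (+-cancelˡ-≡ (suc m) (toℕ i) (toℕ j)
    (trans (sym (lookup∘tabulate _ i)) (trans e (lookup∘tabulate _ j))))

record Interpretation (T : Termlike) (𝓛 : FOLeq T) (S : Signature) : Set₁ where
  open Termlike T using (U) renaming (act to actU)
  open FOLeq 𝓛 using (L) renaming (act to actL)
  open Signature S
  field
    fI     : (f : Fun) → (as : Vec Atom (arF f)) → Distinct as → U
    fI-eqv : ∀ f π as (d : Distinct as) (d' : Distinct (V.map (to π) as)) →
             actU π (fI f as d) ≡ fI f (V.map (to π) as) d'
    pI     : (P : Pred) → (as : Vec Atom (arP P)) → Distinct as → L
    pI-eqv : ∀ P π as (d : Distinct as) (d' : Distinct (V.map (to π) as)) →
             actL π (pI P as d) ≡ pI P (V.map (to π) as) d'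

module Semantics {T : Termlike} {𝓛 : FOLeq T} {S : Signature}
                 (I : Interpretation T 𝓛 S) where
  open Termlike T using (UN; U; subU; atm) renaming (suppL to suppU)
  open FOLeq 𝓛 using (L; LN; subL; meet#; join#; ⊥; _∧_; ¬_; eqA; eqB; eqL)
  open Signature S
  open Interpretation I
  open Syntax S
  module SU = SimSubst UN UN subU
  module SL = SimSubst UN LN subL

  -- f^I(u₁,…,uₙ) = f^I(a₁,…,aₙ)[a₁:=u₁,…,aₙ:=uₙ] for fresh aᵢ
  fExt : (f : Fun) → Vec U (arF f) → U
  fExt f us =
    let m  = maxL (concatMap suppU (V.toList us))
        as = freshVec (arF f) m
    in SU.simSubst (fI f as (freshVec-distinct (arF f) m)) (V.toList (V.zip as us))

  pExt : (P : Pred) → Vec U (arP P) → L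
  pExt P us =
    let m  = maxL (concatMap suppU (V.toList us))
        as = freshVec (arP P) m
    in SL.simSubst (pI P as (freshVec-distinct (arP P) m)) (V.toList (V.zip as us))

  -- u₁ =^I u₂ = (a =^L b)[a:=u₁, b:=u₂]
  _=I_ : U → U → L
  u₁ =I u₂ = SL.simSubst eqL ((eqA , u₁) ∷ (eqB , u₂) ∷ [])

  -- denotation, relative to the atoms naming the bound variables
  mutual
    ⟦_⟧t : ∀ {n} → Term n → Vec Atom n → U
    ⟦ bvar i ⟧t ρ = atm (V.lookup ρ i)
    ⟦ fvar a ⟧t ρ = atm a
    ⟦ app f ts ⟧t ρ = fExt f (⟦ ts ⟧ts ρ)

    ⟦_⟧ts : ∀ {n k} → Vec (Term n) k → Vec Atom n → Vec U k
    ⟦ V.[] ⟧ts ρ = V.[]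
    ⟦ t V.∷ ts ⟧ts ρ = ⟦ t ⟧t ρ V.∷ ⟦ ts ⟧ts ρ

  ⟦_⟧f : ∀ {n} → Form n → Vec Atom n → L
  ⟦ ⊥f ⟧f ρ = ⊥
  ⟦ r ≐ s ⟧f ρ = ⟦ r ⟧t ρ =I ⟦ s ⟧t ρ
  ⟦ pred P ts ⟧f ρ = pExt P (⟦ ts ⟧ts ρ)
  ⟦ φ ∧f ψ ⟧f ρ = ⟦ φ ⟧f ρ ∧ ⟦ ψ ⟧f ρ
  ⟦ ¬f φ ⟧f ρ = ¬ (⟦ φ ⟧f ρ)
  -- [[∀a.φ]] = ⋀^{#a} [[φ]], naming the bound variable by a fresh atom a
  ⟦ ∀f φ ⟧f ρ =
    let a = suc (maxL (fvF φ ++ V.toList ρ))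
    in meet# (a ∷ []) (⟦ φ ⟧f (a V.∷ ρ) ∷ [])

  ⟦_⟧ : Form 0 → L
  ⟦ φ ⟧ = ⟦ φ ⟧f V.[]

module Submission where

-- The propositional rules hold in any distributive complemented
-- lattice and ∀R follows from the distributivity axiom for fresh limits; ∀L,
-- =R and =L reduce to the equality axioms and the substitution lemma
-- [[φ[a:=r]]] = [[φ]][a:=[[r]]].  The nominal work lies in that lemma: the
-- semantics names a bound variable by one canonical fresh atom, and we show
-- any fresh atom will do (fresh-binder).  This needs that denotations are
-- fresh outside their free atoms and invariant under swapping non-free atoms,
-- which in turn rests on f^I, P^I and =^I being defined by substitution into
-- an equivariant body: such operations do not depend on the fresh atoms
-- chosen, are equivariant, commute with substitution and create no atoms.

open import Defs
open import Data.Nat using (ℕ; zero; suc; _<_; s≤s) renaming (_≤_ to _≤ℕ_)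
open import Data.Nat.Properties using (_≟_; m≤m⊔n; m≤n⊔m; <-irrefl; n≤1+n) renaming (≤-refl to ≤ℕ-refl; ≤-trans to ≤ℕ-trans)
open import Data.Fin using (zero; suc; fromℕ; inject₁)
open import Data.Fin.Properties using (0≢1+n; suc-injective)
open import Data.Product using (Σ; _×_; _,_; proj₁; proj₂; ∃)
open import Data.Sum using (_⊎_; inj₁; inj₂)
open import Data.List using (List; []; _∷_; _++_; map; foldl; concatMap)
open import Data.List.Properties using (map-id-local)
open import Data.List.Membership.Propositional using (_∈_; _∉_)
open import Data.List.Membership.Propositional.Properties using (∈-++⁺ˡ; ∈-++⁺ʳ; ∈-++⁻; ∈-map⁺; ∈-map⁻; ∈-concatMap⁺)
open import Data.List.Relation.Unary.Any as Any using (here; there)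
import Data.List.Relation.Unary.All as All
import Data.Vec as V
open import Data.Vec using (Vec; toList)
open import Data.Vec.Properties using (toList-map; map-id; map-∘; lookup-map)
import Data.Unit as Unit
open import Data.Empty using (⊥-elim)
open import Relation.Nullary using (yes; no; Dec)
open import Relation.Binary.PropositionalEquality

∈⇒≤maxL : ∀ {c} as → c ∈ as → c ≤ℕ maxL as
∈⇒≤maxL (a ∷ as) (here refl) = m≤m⊔n a (maxL as)
∈⇒≤maxL (a ∷ as) (there c∈) = ≤ℕ-trans (∈⇒≤maxL as c∈) (m≤n⊔m a (maxL as))

>maxL⇒∉ : ∀ as c → maxL as < c → c ∉ as
>maxL⇒∉ as c lt c∈ = <-irrefl refl (≤ℕ-trans lt (∈⇒≤maxL as c∈))

fresh : List Atom → Atom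
fresh as = suc (maxL as)

fresh-∉ : ∀ as → fresh as ∉ as
fresh-∉ as = >maxL⇒∉ as (fresh as) ≤ℕ-refl

swapA-self : ∀ a d → swapA a a d ≡ d
swapA-self a d = by-cases (d ≟ a)
  where
  by-cases : Dec (d ≡ a) → swapA a a d ≡ d
  by-cases (yes refl) = swapA-a a a
  by-cases (no d≢a) = swapA-other a a d d≢a d≢a

-- Conjugating (b c) by (a c) gives (a b) when c is distinct from a and b;
-- this lets two fresh atoms be exchanged through a third one.
swapA-conjugate : ∀ a b c d → a ≢ b → c ≢ a → c ≢ b →
                  swapA a c (swapA b c (swapA a c d)) ≡ swapA a b d
swapA-conjugate a b c d a≢b c≢a c≢b = by-cases (d ≟ a) (d ≟ b) (d ≟ c)
  where
  open ≡-Reasoning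
  by-cases : Dec (d ≡ a) → Dec (d ≡ b) → Dec (d ≡ c) →
             swapA a c (swapA b c (swapA a c d)) ≡ swapA a b d
  by-cases (yes refl) _ _ =
    begin
      swapA a c (swapA b c (swapA a c a)) ≡⟨ cong (λ z → swapA a c (swapA b c z)) (swapA-a a c) ⟩
      swapA a c (swapA b c c)             ≡⟨ cong (swapA a c) (swapA-b b c) ⟩
      swapA a c b                         ≡⟨ swapA-other a c b (≢-sym a≢b) (≢-sym c≢b) ⟩
      b                                   ≡⟨ sym (swapA-a a b) ⟩
      swapA a b a                         ∎
  by-cases (no d≢a) (yes refl) _ =
    begin
      swapA a c (swapA d c (swapA a c d)) ≡⟨ cong (λ z → swapA a c (swapA d c z)) (swapA-other a c d d≢a (≢-sym c≢b)) ⟩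
      swapA a c (swapA d c d)             ≡⟨ cong (swapA a c) (swapA-a d c) ⟩
      swapA a c c                         ≡⟨ swapA-b a c ⟩
      a                                   ≡⟨ sym (swapA-b a d) ⟩
      swapA a d d                         ∎
  by-cases (no d≢a) (no d≢b) (yes refl) =
    begin
      swapA a d (swapA b d (swapA a d d)) ≡⟨ cong (λ z → swapA a d (swapA b d z)) (swapA-b a d) ⟩
      swapA a d (swapA b d a)             ≡⟨ cong (swapA a d) (swapA-other b d a a≢b (≢-sym c≢a)) ⟩
      swapA a d a                         ≡⟨ swapA-a a d ⟩
      d                                   ≡⟨ sym (swapA-other a b d d≢a d≢b) ⟩
      swapA a b d                         ∎
  by-cases (no d≢a) (no d≢b) (no d≢c) =
    begin
      swapA a c (swapA b c (swapA a c d)) ≡⟨ cong (λ z → swapA a c (swapA b c z)) (swapA-other a c d d≢a d≢c) ⟩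
      swapA a c (swapA b c d)             ≡⟨ cong (swapA a c) (swapA-other b c d d≢b d≢c) ⟩
      swapA a c d                         ≡⟨ swapA-other a c d d≢a d≢c ⟩
      d                                   ≡⟨ sym (swapA-other a b d d≢a d≢b) ⟩
      swapA a b d                         ∎

to-injective : ∀ π {c d} → to π c ≡ to π d → c ≡ d
to-injective π {c} {d} e =
  trans (sym (Perm.from-to π c)) (trans (cong (Perm.from π) e) (Perm.from-to π d))

invP : Perm → Perm
invP π = record
  { to = Perm.from π ; from = Perm.to π
  ; to-from = Perm.from-to π ; from-to = Perm.to-from π
  ; dom = Perm.dom π
  ; fixes-out = λ a a∉ → trans (cong (Perm.from π) (sym (Perm.fixes-out π a a∉)))
                               (Perm.from-to π a)
  }

module NominalFacts (N : NominalSet) where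
  open NominalSet N

  act-invˡ : ∀ π x → act π (act (invP π) x) ≡ x
  act-invˡ π x =
    trans (sym (act-∘ π (invP π) x))
          (trans (act-ext (π ∘P invP π) idP (Perm.to-from π) x) (act-id x))

  act-invʳ : ∀ π x → act (invP π) (act π x) ≡ x
  act-invʳ π x =
    trans (sym (act-∘ (invP π) π x))
          (trans (act-ext (invP π ∘P π) idP (Perm.from-to π) x) (act-id x))

  act-swap-invol : ∀ a b x → act (swapP a b) (act (swapP a b) x) ≡ x
  act-swap-invol a b x =
    trans (sym (act-∘ (swapP a b) (swapP a b) x))
          (trans (act-ext (swapP a b ∘P swapP a b) idP (swapA-invol a b) x) (act-id x))

  supports-act : ∀ {A x} π → Supports act A x → Supports act (map (to π) A) (act π x)
  supports-act {A} {x} π suppA σ σ-fix =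
    trans (sym (act-invˡ π _)) (cong (act π) conj-fixes)
    where
    conj-fixes : act (invP π) (act σ (act π x)) ≡ x
    conj-fixes =
      trans (sym (trans (act-∘ (invP π) (σ ∘P π) x) (cong (act (invP π)) (act-∘ σ π x))))
            (suppA (invP π ∘P (σ ∘P π))
                   (λ c c∈ → trans (cong (Perm.from π) (σ-fix (to π c) (∈-map⁺ (to π) c∈)))
                                   (Perm.from-to π c)))

  #-act : ∀ π {a x} → a # x → to π a # act π x
  #-act π {a} (A , suppA , a∉A) =
    map (to π) A , supports-act π suppA ,
    λ πa∈ → let (c , c∈ , e) = ∈-map⁻ (to π) πa∈
            in a∉A (subst (_∈ A) (sym (to-injective π e)) c∈)

  act-agree : ∀ {A x} π σ → Supports act A x → (∀ c → c ∈ A → to π c ≡ to σ c) →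
              act π x ≡ act σ x
  act-agree {A} {x} π σ suppA agree =
    trans (sym (act-invˡ σ _))
          (cong (act σ) (trans (sym (act-∘ (invP σ) π x))
            (suppA (invP σ ∘P π)
                   (λ c c∈ → trans (cong (Perm.from σ) (agree c c∈)) (Perm.from-to σ c)))))

  ∉suppL⇒# : ∀ {a x} → a ∉ suppL x → a # x
  ∉suppL⇒# {a} {x} a∉ = suppL x , proj₂ (finSupp x) , a∉

  swap-fresh : ∀ {a b x} → a # x → b # x → act (swapP a b) x ≡ x
  swap-fresh {a} {b} {x} (A , suppA , a∉A) (B , suppB , b∉B) with a ≟ b
  ... | yes refl = trans (act-ext (swapP a a) idP (swapA-self a) x) (act-id x)
  ... | no a≢b =
    begin
      act (swapP a b) x
        ≡⟨ act-ext (swapP a b) (swapP a c ∘P (swapP b c ∘P swapP a c))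
                   (λ d → sym (swapA-conjugate a b c d a≢b c≢a c≢b)) x ⟩
      act (swapP a c ∘P (swapP b c ∘P swapP a c)) x
        ≡⟨ act-∘ (swapP a c) (swapP b c ∘P swapP a c) x ⟩
      act (swapP a c) (act (swapP b c ∘P swapP a c) x)
        ≡⟨ cong (act (swapP a c)) (act-∘ (swapP b c) (swapP a c) x) ⟩
      act (swapP a c) (act (swapP b c) (act (swapP a c) x))
        ≡⟨ cong (λ z → act (swapP a c) (act (swapP b c) z)) ac-fixes ⟩
      act (swapP a c) (act (swapP b c) x)
        ≡⟨ cong (act (swapP a c)) bc-fixes ⟩
      act (swapP a c) x
        ≡⟨ ac-fixes ⟩
      x ∎
    where
    open ≡-Reasoning
    c = fresh (a ∷ b ∷ A ++ B)
    c∉ = fresh-∉ (a ∷ b ∷ A ++ B)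
    c≢a : c ≢ a
    c≢a e = c∉ (here e)
    c≢b : c ≢ b
    c≢b e = c∉ (there (here e))
    ac-fixes : act (swapP a c) x ≡ x
    ac-fixes = suppA (swapP a c) (λ d d∈ →
      swapA-other a c d (λ e → a∉A (subst (_∈ A) e d∈))
                        (λ e → c∉ (there (there (∈-++⁺ˡ (subst (_∈ A) e d∈))))))
    bc-fixes : act (swapP b c) x ≡ x
    bc-fixes = suppB (swapP b c) (λ d d∈ →
      swapA-other b c d (λ e → b∉B (subst (_∈ B) e d∈))
                        (λ e → c∉ (there (there (∈-++⁺ʳ A (subst (_∈ B) e d∈))))))

  fresh-by-swap : ∀ x a b → b ∉ suppL x → act (swapP a b) x ≡ x → a # x
  fresh-by-swap x a b b∉ fixes =
    subst (a #_) fixes (subst (_# act (swapP a b) x) (swapA-b a b)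
                              (#-act (swapP a b) (∉suppL⇒# {b} {x} b∉)))

∈-concatMap : ∀ {A B : Set} (f : A → List B) {x y} (xs : List A) →
              y ∈ f x → x ∈ xs → y ∈ concatMap f xs
∈-concatMap f xs y∈ x∈ = ∈-concatMap⁺ f {xs = xs} (Any.map (λ { refl → y∈ }) x∈)

∈-toList-map⁻ : ∀ {A B : Set} {n} (f : A → B) {y} (xs : Vec A n) →
                y ∈ toList (V.map f xs) → ∃ λ x → x ∈ toList xs × y ≡ f x
∈-toList-map⁻ f xs y∈ = ∈-map⁻ f (subst (_ ∈_) (toList-map f xs) y∈)

∈-lookup : ∀ {A : Set} {n} (xs : Vec A n) i → V.lookup xs i ∈ toList xs
∈-lookup (x V.∷ xs) zero = here refl
∈-lookup (x V.∷ xs) (suc i) = there (∈-lookup xs i)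

lookup-of-∈ : ∀ {A : Set} {n} (xs : Vec A n) {x} → x ∈ toList xs → ∃ λ i → V.lookup xs i ≡ x
lookup-of-∈ (x V.∷ xs) (here refl) = zero , refl
lookup-of-∈ (x V.∷ xs) (there x∈) = let (i , e) = lookup-of-∈ xs x∈ in suc i , e

map-cong-on : ∀ {A B : Set} {n} (f g : A → B) (xs : Vec A n) →
              (∀ x → x ∈ toList xs → f x ≡ g x) → V.map f xs ≡ V.map g xs
map-cong-on f g V.[] agree = refl
map-cong-on f g (x V.∷ xs) agree =
  cong₂ V._∷_ (agree x (here refl)) (map-cong-on f g xs (λ y y∈ → agree y (there y∈)))

map-id-on : ∀ {A : Set} {n} (f : A → A) (xs : Vec A n) →
            (∀ x → x ∈ toList xs → f x ≡ x) → V.map f xs ≡ xs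
map-id-on f xs fixes = trans (map-cong-on f (λ x → x) xs fixes) (map-id xs)

map-≡⇒pointwise : ∀ {A B : Set} {n} (f g : A → B) (xs : Vec A n) →
                  V.map f xs ≡ V.map g xs → ∀ x → x ∈ toList xs → f x ≡ g x
map-≡⇒pointwise f g (y V.∷ xs) e x (here refl) = cong V.head e
map-≡⇒pointwise f g (y V.∷ xs) e x (there x∈) = map-≡⇒pointwise f g xs (cong V.tail e) x x∈

-- Pairwise distinct atoms, in the inductive form convenient for recursion.
Nodup : ∀ {n} → Vec Atom n → Set
Nodup V.[] = Unit.⊤
Nodup (a V.∷ as) = a ∉ toList as × Nodup as

Apart : ∀ {n m} → Vec Atom n → Vec Atom m → Set
Apart xs ys = ∀ c → c ∈ toList xs → c ∉ toList ys

Nodup⇒Distinct : ∀ {n} (as : Vec Atom n) → Nodup as → Distinct as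
Nodup⇒Distinct (a V.∷ as) (a∉ , nodup) zero zero e = refl
Nodup⇒Distinct (a V.∷ as) (a∉ , nodup) zero (suc j) e =
  ⊥-elim (a∉ (subst (_∈ toList as) (sym e) (∈-lookup as j)))
Nodup⇒Distinct (a V.∷ as) (a∉ , nodup) (suc i) zero e =
  ⊥-elim (a∉ (subst (_∈ toList as) e (∈-lookup as i)))
Nodup⇒Distinct (a V.∷ as) (a∉ , nodup) (suc i) (suc j) e = cong suc (Nodup⇒Distinct as nodup i j e)

Distinct⇒Nodup : ∀ {n} (as : Vec Atom n) → Distinct as → Nodup as
Distinct⇒Nodup V.[] distinct = Unit.tt
Distinct⇒Nodup (a V.∷ as) distinct =
  (λ a∈ → let (j , e) = lookup-of-∈ as a∈ in 0≢1+n (distinct zero (suc j) (sym e))) ,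
  Distinct⇒Nodup as (λ i j e → suc-injective (distinct (suc i) (suc j) e))

run : ∀ n → ℕ → Vec Atom n
run zero k = V.[]
run (suc n) k = k V.∷ run n (suc k)

run-≥ : ∀ n k {c} → c ∈ toList (run n k) → k ≤ℕ c
run-≥ (suc n) k (here refl) = ≤ℕ-refl
run-≥ (suc n) k (there c∈) = ≤ℕ-trans (n≤1+n k) (run-≥ n (suc k) c∈)

run-nodup : ∀ n k → Nodup (run n k)
run-nodup zero k = Unit.tt
run-nodup (suc n) k = (λ k∈ → <-irrefl refl (run-≥ n (suc k) k∈)) , run-nodup n (suc k)

freshRun : ∀ n (avoid : List Atom) → Vec Atom n
freshRun n avoid = run n (fresh avoid)

freshRun-∉ : ∀ n avoid c → c ∈ toList (freshRun n avoid) → c ∉ avoid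
freshRun-∉ n avoid c c∈ = >maxL⇒∉ avoid c (run-≥ n (fresh avoid) c∈)

renP : ∀ {n} → Vec Atom n → Vec Atom n → Perm
renP V.[] V.[] = idP
renP (k V.∷ ks) (k' V.∷ ks') = renP ks ks' ∘P swapP k' k

renP-fix : ∀ {n} (ks ks' : Vec Atom n) c → c ∉ toList ks → c ∉ toList ks' →
           to (renP ks ks') c ≡ c
renP-fix V.[] V.[] c _ _ = refl
renP-fix (k V.∷ ks) (k' V.∷ ks') c c∉ks c∉ks' =
  trans (cong (to (renP ks ks')) (swapA-other k' k c (λ e → c∉ks' (here e)) (λ e → c∉ks (here e))))
        (renP-fix ks ks' c (λ c∈ → c∉ks (there c∈)) (λ c∈ → c∉ks' (there c∈)))

renP-map : ∀ {n} (ks ks' : Vec Atom n) → Nodup ks → Nodup ks' → Apart ks' ks →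
           V.map (to (renP ks ks')) ks ≡ ks'
renP-map V.[] V.[] _ _ _ = refl
renP-map (k V.∷ ks) (k' V.∷ ks') (k∉ , nodup) (k'∉ , nodup') apart =
  cong₂ V._∷_
    (trans (cong (to (renP ks ks')) (swapA-b k' k))
           (renP-fix ks ks' k' (λ k'∈ → apart k' (here refl) (there k'∈)) k'∉))
    (trans (map-cong-on _ _ ks (λ c c∈ → cong (to (renP ks ks'))
              (swapA-other k' k c (λ e → apart k' (here refl) (there (subst (_∈ toList ks) e c∈)))
                                  (λ e → k∉ (subst (_∈ toList ks) e c∈)))))
           (renP-map ks ks' nodup nodup' (λ c c∈ c∈' → apart c (there c∈) (there c∈'))))

module RenamingFacts (N : NominalSet) where
  open NominalSet N
  open NominalFacts N

  renP-act-fresh : ∀ {n} (ks ks' : Vec Atom n) x →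
                   (∀ c → c ∈ toList ks → c # x) → (∀ c → c ∈ toList ks' → c # x) →
                   act (renP ks ks') x ≡ x
  renP-act-fresh V.[] V.[] x _ _ = act-id x
  renP-act-fresh (k V.∷ ks) (k' V.∷ ks') x ks#x ks'#x =
    trans (act-∘ (renP ks ks') (swapP k' k) x)
      (trans (cong (act (renP ks ks')) (swap-fresh (ks'#x k' (here refl)) (ks#x k (here refl))))
             (renP-act-fresh ks ks' x (λ c c∈ → ks#x c (there c∈)) (λ c c∈ → ks'#x c (there c∈))))

module SigmaFacts (T : Termlike) (X : NominalSet)
                  (sub : Carrier X → Atom → Termlike.U T → Carrier X)
                  (isσ : IsSigmaAlg (Termlike.UN T) (Termlike.atm T) (Termlike.subU T) X sub) where
  open Termlike T using (UN; U; subU) renaming (act to actU; _#_ to _#U_; suppL to suppU)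
  open NominalSet X renaming (Carrier to C)
  open IsSigmaAlg isσ
  private
    module NX = NominalFacts X
    module NU = NominalFacts UN
    module RU = RenamingFacts UN

  sub-# : ∀ {c x a u} → c # x → c #U u → c ≢ a → c # sub x a u
  sub-# {c} {x} {a} {u} c#x c#u c≢a =
    NX.fresh-by-swap (sub x a u) c b (λ b∈ → b∉ (there (there (∈-++⁺ˡ b∈)))) swap-fixes
    where
    avoid = c ∷ a ∷ suppL (sub x a u) ++ suppL x ++ suppU u
    b = fresh avoid
    b∉ = fresh-∉ avoid
    b#x : b # x
    b#x = NX.∉suppL⇒# (λ b∈ → b∉ (there (there (∈-++⁺ʳ (suppL (sub x a u)) (∈-++⁺ˡ b∈)))))
    b#u : b #U u
    b#u = NU.∉suppL⇒# (λ b∈ → b∉ (there (there (∈-++⁺ʳ (suppL (sub x a u)) (∈-++⁺ʳ (suppL x) b∈)))))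
    swap-fixes : act (swapP c b) (sub x a u) ≡ sub x a u
    swap-fixes =
      trans (sub-eqv (swapP c b) x a u)
            (cong₂ (λ y q → sub y (proj₁ q) (proj₂ q)) (NX.swap-fresh c#x b#x)
               (cong₂ _,_ (swapA-other c b a (≢-sym c≢a) (λ e → b∉ (there (here (sym e)))))
                          (NU.swap-fresh c#u b#u)))

  AllFresh : ∀ {n m} → Vec Atom n → Vec U m → Set
  AllFresh ks us = ∀ c → c ∈ toList ks → ∀ u → u ∈ toList us → c #U u

  seqSub : ∀ {n} → C → Vec Atom n → Vec U n → C
  seqSub y V.[] V.[] = y
  seqSub y (k V.∷ ks) (u V.∷ us) = seqSub (sub y k u) ks us

  seqSub-act : ∀ {n} π y (ks : Vec Atom n) us →
               act π (seqSub y ks us) ≡ seqSub (act π y) (V.map (to π) ks) (V.map (actU π) us)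
  seqSub-act π y V.[] V.[] = refl
  seqSub-act π y (k V.∷ ks) (u V.∷ us) =
    trans (seqSub-act π (sub y k u) ks us)
          (cong (λ z → seqSub z (V.map (to π) ks) (V.map (actU π) us)) (sub-eqv π y k u))

  seqSub-sub : ∀ {n} y (ks : Vec Atom n) us a w → a ∉ toList ks →
               (∀ k → k ∈ toList ks → k #U w) →
               sub (seqSub y ks us) a w ≡ seqSub (sub y a w) ks (V.map (λ u → subU u a w) us)
  seqSub-sub y V.[] V.[] a w _ _ = refl
  seqSub-sub y (k V.∷ ks) (u V.∷ us) a w a∉ ks#w =
    trans (seqSub-sub (sub y k u) ks us a w (λ a∈ → a∉ (there a∈)) (λ k' k'∈ → ks#w k' (there k'∈)))
          (cong (λ z → seqSub z ks (V.map (λ u → subU u a w) us))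
                (σ-σ y k a u w (λ e → a∉ (here (sym e))) (ks#w k (here refl))))

  -- α-renaming: the targets of a sequential substitution may be renamed to
  -- fresh distinct atoms ks', using the axiom x[a:=u] = ((b a)·x)[b:=u].
  seqSub-rename : ∀ {n} (ks ks' : Vec Atom n) us y → Nodup ks' → Apart ks' ks →
                  (∀ c → c ∈ toList ks' → c # y) → AllFresh ks us → AllFresh ks' us →
                  seqSub y ks us ≡ seqSub (act (renP ks ks') y) ks' us
  seqSub-rename V.[] V.[] V.[] y _ _ _ _ _ = sym (act-id y)
  seqSub-rename (k V.∷ ks) (k' V.∷ ks') (u V.∷ us) y (k'∉ , nodup') apart ks'#y ks#us ks'#us =
    begin
      seqSub (sub y k u) ks us
        ≡⟨ cong (λ z → seqSub z ks us) (σ-α y k k' u k≢k' (ks'#y k' (here refl))) ⟩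
      seqSub y₁ ks us
        ≡⟨ seqSub-rename ks ks' us y₁ nodup' (λ c c∈ c∈' → apart c (there c∈) (there c∈'))
                         ks'#y₁ (λ c c∈ v v∈ → ks#us c (there c∈) v (there v∈))
                                (λ c c∈ v v∈ → ks'#us c (there c∈) v (there v∈)) ⟩
      seqSub (act ρ y₁) ks' us
        ≡⟨ cong (λ z → seqSub z ks' us) rename-y₁ ⟩
      seqSub (sub (act (ρ ∘P swapP k' k) y) k' u) ks' us ∎
    where
    open ≡-Reasoning
    ρ = renP ks ks'
    y₁ = sub (act (swapP k' k) y) k' u
    k≢k' : k ≢ k'
    k≢k' e = apart k' (here refl) (here (sym e))
    k'∉ks : k' ∉ toList ks
    k'∉ks k'∈ = apart k' (here refl) (there k'∈)
    ks'#y₁ : ∀ c → c ∈ toList ks' → c # y₁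
    ks'#y₁ c c∈ =
      sub-# (subst (_# act (swapP k' k) y)
                   (swapA-other k' k c (λ e → k'∉ (subst (_∈ toList ks') e c∈))
                                       (λ e → apart c (there c∈) (here e)))
                   (NX.#-act (swapP k' k) (ks'#y c (there c∈))))
            (ks'#us c (there c∈) u (here refl))
            (λ e → k'∉ (subst (_∈ toList ks') e c∈))
    rename-y₁ : act ρ y₁ ≡ sub (act (ρ ∘P swapP k' k) y) k' u
    rename-y₁ =
      trans (sub-eqv ρ (act (swapP k' k) y) k' u)
            (cong₂ (λ z q → sub z (proj₁ q) (proj₂ q)) (sym (act-∘ ρ (swapP k' k) y))
               (cong₂ _,_ (renP-fix ks ks' k' k'∉ks k'∉)
                          (RU.renP-act-fresh ks ks' u (λ c c∈ → ks#us c (there c∈) u (here refl))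
                                                      (λ c c∈ → ks'#us c (there c∈) u (here refl)))))

  module SS = SimSubst UN X sub

  private
    substStep : C → Atom × U → C
    substStep y q = sub y (proj₁ q) (proj₂ q)

    foldl-seqSub : ∀ {n} y (ks : Vec Atom n) us →
                   foldl substStep y (toList (V.zip ks us)) ≡ seqSub y ks us
    foldl-seqSub y V.[] V.[] = refl
    foldl-seqSub y (k V.∷ ks) (u V.∷ us) = foldl-seqSub (sub y k u) ks us

    renameFrom-run : ∀ {n} k (as : Vec Atom n) (us : Vec U n) → Nodup as →
                     (∀ c → c ∈ toList as → c < k) →
                     let r = SS.renameFrom k (toList (V.zip as us)) in
                     (proj₂ r ≡ toList (V.zip (run n k) us))
                     × (V.map (to (proj₁ r)) as ≡ run n k)
                     × (∀ c → c ∉ toList as → c < k → to (proj₁ r) c ≡ c)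
    renameFrom-run k V.[] V.[] _ _ = refl , refl , λ _ _ _ → refl
    renameFrom-run {suc n} k (a V.∷ as) (u V.∷ us) (a∉ , nodup) below
      with SS.renameFrom (suc k) (toList (V.zip as us))
         | renameFrom-run (suc k) as us nodup (λ c c∈ → ≤ℕ-trans (below c (there c∈)) (n≤1+n k))
    ... | (π , qs) | (qs≡ , maps , fixes) = cong ((k , u) ∷_) qs≡ , cong₂ V._∷_ head-maps tail-maps , fixes′
      where
      a<k : a < k
      a<k = below a (here refl)
      head-maps : swapA k a (to π a) ≡ k
      head-maps = trans (cong (swapA k a) (fixes a a∉ (≤ℕ-trans a<k (n≤1+n k)))) (swapA-b k a)
      tail-maps : V.map (λ c → swapA k a (to π c)) as ≡ run n (suc k)
      tail-maps =
        trans (map-∘ (swapA k a) (to π) as)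
          (trans (cong (V.map (swapA k a)) maps)
            (map-id-on (swapA k a) (run n (suc k)) (λ c c∈ →
               swapA-other k a c (λ e → <-irrefl (sym e) (run-≥ n (suc k) c∈))
                                 (λ e → <-irrefl refl (≤ℕ-trans a<k (subst (k ≤ℕ_) e
                                          (≤ℕ-trans (n≤1+n k) (run-≥ n (suc k) c∈))))))))
      fixes′ : ∀ c → c ∉ toList (a V.∷ as) → c < k → swapA k a (to π c) ≡ c
      fixes′ c c∉ c<k =
        trans (cong (swapA k a) (fixes c (λ c∈ → c∉ (there c∈)) (≤ℕ-trans c<k (n≤1+n k))))
              (swapA-other k a c (λ e → <-irrefl e c<k) (λ e → c∉ (here e)))

    proj₁-zip : ∀ {n} (as : Vec Atom n) (us : Vec U n) → map proj₁ (toList (V.zip as us)) ≡ toList as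
    proj₁-zip V.[] V.[] = refl
    proj₁-zip (a V.∷ as) (u V.∷ us) = cong (a ∷_) (proj₁-zip as us)

    zip-∈ : ∀ {n} (as : Vec Atom n) (us : Vec U n) {u} → u ∈ toList us →
            ∃ λ a → (a , u) ∈ toList (V.zip as us)
    zip-∈ (a V.∷ as) (u V.∷ us) (here refl) = a , here refl
    zip-∈ (a V.∷ as) (u V.∷ us) (there u∈) = let (b , b∈) = zip-∈ as us u∈ in b , there b∈

  -- The simultaneous substitution x[a₁:=u₁,…,aₙ:=uₙ] of Defs, unfolded as a
  -- permutation followed by a sequential substitution with fresh targets.
  record Unfolding {n} (x : C) (as : Vec Atom n) (us : Vec U n) : Set where
    field
      targets  : Vec Atom n
      perm     : Perm
      nodup    : Nodup targets
      fresh-us : AllFresh targets us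
      apart    : Apart targets as
      maps     : V.map (to perm) as ≡ targets
      unfolds  : SS.simSubst x (toList (V.zip as us)) ≡ seqSub (act perm x) targets us

  simSubst-unfold : ∀ {n} x (as : Vec Atom n) (us : Vec U n) → Nodup as → Unfolding x as us
  simSubst-unfold {n} x as us nodup = record
    { targets  = run n k
    ; perm     = proj₁ r
    ; nodup    = run-nodup n k
    ; fresh-us = λ c c∈ u u∈ → NU.∉suppL⇒# (λ c∈u → above c c∈
        (∈-++⁺ʳ (suppL x) (∈-++⁺ʳ (map proj₁ ps)
           (∈-concatMap (λ p → suppU (proj₂ p)) ps c∈u (proj₂ (zip-∈ as us u∈))))))
    ; apart    = λ c c∈ c∈as → above c c∈ (∈-++⁺ʳ (suppL x) (∈-++⁺ˡ (subst (c ∈_) (sym (proj₁-zip as us)) c∈as)))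
    ; maps     = proj₁ (proj₂ run-facts)
    ; unfolds  = trans (cong (foldl substStep (act (proj₁ r) x)) (proj₁ run-facts))
                       (foldl-seqSub (act (proj₁ r) x) (run n k) us)
    }
    where
    ps = toList (V.zip as us)
    bounded = suppL x ++ map proj₁ ps ++ concatMap (λ p → suppU (proj₂ p)) ps
    k = suc (maxL bounded)
    r = SS.renameFrom k ps
    above : ∀ c → c ∈ toList (run n k) → c ∉ bounded
    above c c∈ = >maxL⇒∉ bounded c (run-≥ n k c∈)
    run-facts = renameFrom-run k as us nodup (λ c c∈ → s≤s (∈⇒≤maxL bounded
                  (∈-++⁺ʳ (suppL x) (∈-++⁺ˡ (subst (c ∈_) (sym (proj₁-zip as us)) c∈)))))

-- Operations on a σ-algebra X that are "defined by substitution": op(u⃗) is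
-- an equivariant body b(k⃗) with u⃗ substituted for fresh atoms k⃗.  Like
-- f^I, P^I and =^I, such operations do not depend on the choice of k⃗, are
-- equivariant, commute with substitution and do not create atoms.
module SubstDefined (T : Termlike) (X : NominalSet)
                    (sub : Carrier X → Atom → Termlike.U T → Carrier X)
                    (isσ : IsSigmaAlg (Termlike.UN T) (Termlike.atm T) (Termlike.subU T) X sub) where
  open Termlike T using (UN; U; subU) renaming (act to actU; _#_ to _#U_; suppL to suppU)
  open NominalSet X renaming (Carrier to C)
  open IsSigmaAlg isσ
  open SigmaFacts T X sub isσ
  private
    module NX = NominalFacts X
    module NU = NominalFacts UN
    module ΣU = SigmaFacts T UN subU (Termlike.isσ T)

  suppsU : ∀ {m} → Vec U m → List Atom
  suppsU us = concatMap suppU (toList us)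

  ∉suppsU⇒AllFresh : ∀ {n m} (ks : Vec Atom n) (us : Vec U m) →
                      (∀ c → c ∈ toList ks → c ∉ suppsU us) → AllFresh ks us
  ∉suppsU⇒AllFresh ks us ks∉ c c∈ u u∈ = NU.∉suppL⇒# (λ c∈u → ks∉ c c∈ (∈-concatMap suppU (toList us) c∈u u∈))

  record Presentation {n : ℕ} (op : Vec U n → C) : Set₁ where
    field
      Admissible   : Vec Atom n → Set
      body         : (ks : Vec Atom n) → Admissible ks → C
      adm-nodup    : ∀ ks → Admissible ks → Nodup ks
      body-supp    : ∀ ks adm → Supports act (toList ks) (body ks adm)
      body-rename  : ∀ ks adm ks' adm' → Apart ks' ks →
                     act (renP ks ks') (body ks adm) ≡ body ks' adm'
      adm-avoiding : ∀ (avoid : List Atom) →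
                     Σ (Vec Atom n) λ ks → Admissible ks × (∀ c → c ∈ toList ks → c ∉ avoid)
      presented    : ∀ us → Σ (Vec Atom n) λ ks → Σ (Admissible ks) λ adm →
                     AllFresh ks us × (op us ≡ seqSub (body ks adm) ks us)

  module PresentationFacts {n : ℕ} {op : Vec U n → C} (P : Presentation op) where
    open Presentation P

    body-# : ∀ ks adm c → c ∉ toList ks → c # body ks adm
    body-# ks adm c c∉ = toList ks , body-supp ks adm , c∉

    -- Two admissible presentations agree, by renaming both to fresh targets.
    rename-targets : ∀ us ks adm ks' adm' → Apart ks' ks → AllFresh ks us → AllFresh ks' us →
                     seqSub (body ks adm) ks us ≡ seqSub (body ks' adm') ks' us
    rename-targets us ks adm ks' adm' apart ks#us ks'#us =
      trans (seqSub-rename ks ks' us (body ks adm) (adm-nodup ks' adm') apart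
                           (λ c c∈ → body-# ks adm c (apart c c∈)) ks#us ks'#us)
            (cong (λ z → seqSub z ks' us) (body-rename ks adm ks' adm' apart))

    op-any : ∀ us ks adm → AllFresh ks us → op us ≡ seqSub (body ks adm) ks us
    op-any us ks adm ks#us =
      trans op≡ (trans (rename-targets us ks₀ adm₀ ks₂ adm₂ (λ c c∈ c∈₀ → ks₂∉ c c∈ (∈-++⁺ˡ c∈₀)) ks₀#us ks₂#us)
                       (sym (rename-targets us ks adm ks₂ adm₂
                               (λ c c∈ c∈' → ks₂∉ c c∈ (∈-++⁺ʳ (toList ks₀) (∈-++⁺ˡ c∈'))) ks#us ks₂#us)))
      where
      ks₀ = proj₁ (presented us)
      adm₀ = proj₁ (proj₂ (presented us))
      ks₀#us = proj₁ (proj₂ (proj₂ (presented us)))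
      op≡ = proj₂ (proj₂ (proj₂ (presented us)))
      avoid = toList ks₀ ++ toList ks ++ suppsU us
      ks₂ = proj₁ (adm-avoiding avoid)
      adm₂ = proj₁ (proj₂ (adm-avoiding avoid))
      ks₂∉ = proj₂ (proj₂ (adm-avoiding avoid))
      ks₂#us = ∉suppsU⇒AllFresh ks₂ us (λ c c∈ c∈us → ks₂∉ c c∈ (∈-++⁺ʳ (toList ks₀) (∈-++⁺ʳ (toList ks) c∈us)))

    op-swap : ∀ c d us → act (swapP c d) (op us) ≡ op (V.map (actU (swapP c d)) us)
    op-swap c d us =
      begin
        act (swapP c d) (op us)
          ≡⟨ cong (act (swapP c d)) (op-any us ks adm ks#us) ⟩
        act (swapP c d) (seqSub (body ks adm) ks us)
          ≡⟨ seqSub-act (swapP c d) (body ks adm) ks us ⟩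
        seqSub (act (swapP c d) (body ks adm)) (V.map (swapA c d) ks) us'
          ≡⟨ cong₂ (λ y ks″ → seqSub y ks″ us')
                   (NX.swap-fresh (body-# ks adm c (λ c∈ → ks∉ c c∈ (here refl)))
                                  (body-# ks adm d (λ d∈ → ks∉ d d∈ (there (here refl)))))
                   (map-id-on (swapA c d) ks (λ k k∈ →
                      swapA-other c d k (λ e → ks∉ c (subst (_∈ toList ks) e k∈) (here refl))
                                        (λ e → ks∉ d (subst (_∈ toList ks) e k∈) (there (here refl))))) ⟩
        seqSub (body ks adm) ks us'
          ≡⟨ sym (op-any us' ks adm ks#us') ⟩
        op us' ∎
      where
      open ≡-Reasoning
      us' = V.map (actU (swapP c d)) us
      avoid = c ∷ d ∷ suppsU us ++ suppsU us'
      ks = proj₁ (adm-avoiding avoid)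
      adm = proj₁ (proj₂ (adm-avoiding avoid))
      ks∉ = proj₂ (proj₂ (adm-avoiding avoid))
      ks#us = ∉suppsU⇒AllFresh ks us (λ c' c'∈ c'∈us → ks∉ c' c'∈ (there (there (∈-++⁺ˡ c'∈us))))
      ks#us' = ∉suppsU⇒AllFresh ks us' (λ c' c'∈ c'∈us → ks∉ c' c'∈ (there (there (∈-++⁺ʳ (suppsU us) c'∈us))))

    op-sub : ∀ a w us → sub (op us) a w ≡ op (V.map (λ u → subU u a w) us)
    op-sub a w us =
      begin
        sub (op us) a w
          ≡⟨ cong (λ z → sub z a w) (op-any us ks adm ks#us) ⟩
        sub (seqSub (body ks adm) ks us) a w
          ≡⟨ seqSub-sub (body ks adm) ks us a w (λ a∈ → ks∉ a a∈ (here refl)) ks#w ⟩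
        seqSub (sub (body ks adm) a w) ks us'
          ≡⟨ cong (λ z → seqSub z ks us') (σ-# (body ks adm) a w (body-# ks adm a (λ a∈ → ks∉ a a∈ (here refl)))) ⟩
        seqSub (body ks adm) ks us'
          ≡⟨ sym (op-any us' ks adm ks#us') ⟩
        op us' ∎
      where
      open ≡-Reasoning
      us' = V.map (λ u → subU u a w) us
      avoid = a ∷ suppU w ++ suppsU us
      ks = proj₁ (adm-avoiding avoid)
      adm = proj₁ (proj₂ (adm-avoiding avoid))
      ks∉ = proj₂ (proj₂ (adm-avoiding avoid))
      ks#us = ∉suppsU⇒AllFresh ks us (λ c c∈ c∈us → ks∉ c c∈ (there (∈-++⁺ʳ (suppU w) c∈us)))
      ks#w : ∀ k → k ∈ toList ks → k #U w
      ks#w k k∈ = NU.∉suppL⇒# (λ k∈w → ks∉ k k∈ (there (∈-++⁺ˡ k∈w)))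
      ks#us' : AllFresh ks us'
      ks#us' c c∈ u' u'∈ =
        let (u , u∈ , e) = ∈-toList-map⁻ (λ u → subU u a w) us u'∈
        in subst (c #U_) (sym e) (ΣU.sub-# (ks#us c c∈ u u∈) (ks#w c c∈) (λ e' → ks∉ c c∈ (here e')))

    op-fresh : ∀ a us → (∀ u → u ∈ toList us → a #U u) → a # op us
    op-fresh a us a#us =
      NX.fresh-by-swap (op us) a b (λ b∈ → b∉ (there (∈-++⁺ˡ b∈)))
        (trans (op-swap a b us)
               (cong op (map-id-on _ us (λ u u∈ → NU.swap-fresh (a#us u u∈)
                  (NU.∉suppL⇒# (λ b∈ → b∉ (there (∈-++⁺ʳ (suppL (op us)) (∈-concatMap suppU (toList us) b∈ u∈)))))))))
      where
      avoid = a ∷ suppL (op us) ++ suppsU us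
      b = fresh avoid
      b∉ = fresh-∉ avoid

  -- The extension of an equivariant family h indexed by distinct atoms:
  -- h(u⃗) = h(a⃗)[a⃗:=u⃗] for the canonical fresh a⃗ (as for f^I and P^I).
  module EquivariantFamily {n : ℕ} (h : (as : Vec Atom n) → Distinct as → C)
         (h-eqv : ∀ π as (d : Distinct as) (d' : Distinct (V.map (to π) as)) →
                  act π (h as d) ≡ h (V.map (to π) as) d') where

    extend : Vec U n → C
    extend us =
      let m  = maxL (concatMap suppU (toList us))
          as = freshVec n m
      in SS.simSubst (h as (freshVec-distinct n m)) (toList (V.zip as us))

    h-act : ∀ π as bs (d : Distinct as) (d' : Distinct bs) → V.map (to π) as ≡ bs →
            act π (h as d) ≡ h bs d'
    h-act π as bs d d' πas≡bs =
      trans (h-eqv π as d (subst Distinct (sym πas≡bs) d')) (h-cong πas≡bs)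
      where
      h-cong : ∀ {as′} (e : as′ ≡ bs) → h as′ (subst Distinct (sym e) d') ≡ h bs d'
      h-cong refl = refl

    presentation : Presentation extend
    presentation = record
      { Admissible   = Nodup
      ; body         = body
      ; adm-nodup    = λ ks nodup → nodup
      ; body-supp    = λ ks nodup π fixes →
          h-act π ks ks _ _ (map-id-on (to π) ks fixes)
      ; body-rename  = λ ks nodup ks' nodup' apart →
          h-act (renP ks ks') ks ks' _ _ (renP-map ks ks' nodup nodup' apart)
      ; adm-avoiding = λ avoid → freshRun n avoid , run-nodup n _ , freshRun-∉ n avoid
      ; presented    = presented
      }
      where
      body : (ks : Vec Atom n) → Nodup ks → C
      body ks nodup = h ks (Nodup⇒Distinct ks nodup)
      presented : ∀ us → Σ (Vec Atom n) λ ks → Σ (Nodup ks) λ nodup →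
                  AllFresh ks us × (extend us ≡ seqSub (body ks nodup) ks us)
      presented us =
        targets , nodup , fresh-us ,
        trans unfolds (cong (λ z → seqSub z targets us) (h-act perm as targets _ _ maps))
        where
        m = maxL (concatMap suppU (toList us))
        as = freshVec n m
        open Unfolding (simSubst-unfold (h as (freshVec-distinct n m)) as us
                                        (Distinct⇒Nodup as (freshVec-distinct n m)))

module LatticeFacts (T : Termlike) (𝓛 : FOLeq T) where
  open FOLeq 𝓛
  private
    module NL = NominalFacts LN

  ≡⇒≤ : ∀ {x y} → x ≡ y → x ≤ y
  ≡⇒≤ {x} refl = ≤-refl x

  infixr 5 _⟨≤⟩_
  _⟨≤⟩_ : ∀ {x y z} → x ≤ y → y ≤ z → x ≤ z
  _⟨≤⟩_ {x} {y} {z} = ≤-trans x y z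

  ⋀ : List L → L
  ⋀ = meet# []

  ⋁ : List L → L
  ⋁ = join# []

  ⋀-lb : ∀ {X x} → x ∈ X → ⋀ X ≤ x
  ⋀-lb {X} {x} = meet#-lb [] X x

  ⋀-greatest : ∀ {X y} → (∀ x → x ∈ X → y ≤ x) → y ≤ ⋀ X
  ⋀-greatest {X} {y} = meet#-great [] X y (λ _ ())

  ⋁-ub : ∀ {X x} → x ∈ X → x ≤ ⋁ X
  ⋁-ub {X} {x} = join#-ub [] X x

  ⋁-least : ∀ {X y} → (∀ x → x ∈ X → x ≤ y) → ⋁ X ≤ y
  ⋁-least {X} {y} = join#-least [] X y (λ _ ())

  ∧-≤ˡ : ∀ {x y} → (x ∧ y) ≤ x
  ∧-≤ˡ = ⋀-lb (here refl)

  ∧-≤ʳ : ∀ {x y} → (x ∧ y) ≤ y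
  ∧-≤ʳ = ⋀-lb (there (here refl))

  ∧-greatest : ∀ {x y z} → z ≤ x → z ≤ y → z ≤ (x ∧ y)
  ∧-greatest z≤x z≤y = ⋀-greatest (λ { _ (here refl) → z≤x ; _ (there (here refl)) → z≤y })

  ∨-≥ˡ : ∀ {x y} → x ≤ (x ∨ y)
  ∨-≥ˡ = ⋁-ub (here refl)

  ∨-≥ʳ : ∀ {x y} → y ≤ (x ∨ y)
  ∨-≥ʳ = ⋁-ub (there (here refl))

  ∨-least : ∀ {x y z} → x ≤ z → y ≤ z → (x ∨ y) ≤ z
  ∨-least x≤z y≤z = ⋁-least (λ { _ (here refl) → x≤z ; _ (there (here refl)) → y≤z })

  ≤-⊤ : ∀ {x} → x ≤ ⊤
  ≤-⊤ = ⋀-greatest (λ _ ())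

  ⊥-≤ : ∀ {x} → ⊥ ≤ x
  ⊥-≤ = ⋁-least (λ _ ())

  ∨-comm-≤ : ∀ {x y} → (x ∨ y) ≤ (y ∨ x)
  ∨-comm-≤ = ∨-least ∨-≥ʳ ∨-≥ˡ

  distrib-≤ : ∀ x y z → ((x ∨ y) ∧ (x ∨ z)) ≤ (x ∨ (y ∧ z))
  distrib-≤ x y z = ≡⇒≤ (sym (distrib x y z))

  ⊤-≤-¬∨ : ∀ {y} → ⊤ ≤ ((¬ y) ∨ y)
  ⊤-≤-¬∨ {y} = ≡⇒≤ (sym (∨-compl y)) ⟨≤⟩ ∨-comm-≤

  compl-unique : ∀ y z → (y ∧ z) ≡ ⊥ → (y ∨ z) ≡ ⊤ → z ≡ (¬ y)
  compl-unique y z y∧z≡⊥ y∨z≡⊤ = ≤-antisym z (¬ y) z≤¬y ¬y≤z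
    where
    z≤¬y : z ≤ (¬ y)
    z≤¬y = ∧-greatest (≤-⊤ ⟨≤⟩ ⊤-≤-¬∨) ∨-≥ʳ
           ⟨≤⟩ distrib-≤ (¬ y) y z
           ⟨≤⟩ ∨-least (≤-refl (¬ y)) (≡⇒≤ y∧z≡⊥ ⟨≤⟩ ⊥-≤)
    ¬y≤z : (¬ y) ≤ z
    ¬y≤z = ∧-greatest (≤-⊤ ⟨≤⟩ ≡⇒≤ (sym y∨z≡⊤) ⟨≤⟩ ∨-comm-≤) ∨-≥ʳ
           ⟨≤⟩ distrib-≤ z y (¬ y)
           ⟨≤⟩ ∨-least (≤-refl z) (≡⇒≤ (∧-compl y) ⟨≤⟩ ⊥-≤)

  ⋁-cons-≤ : ∀ {x X} → ⋁ (x ∷ X) ≤ (⋁ X ∨ x)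
  ⋁-cons-≤ = ⋁-least (λ { _ (here refl) → ∨-≥ʳ ; y (there y∈) → ⋁-ub y∈ ⟨≤⟩ ∨-≥ˡ })

  ⋁-cons-≥ : ∀ {x X} → (⋁ X ∨ x) ≤ ⋁ (x ∷ X)
  ⋁-cons-≥ = ∨-least (⋁-least (λ y y∈ → ⋁-ub (there y∈))) (⋁-ub (here refl))

  meet#-act : ∀ π A X → act π (meet# A X) ≡ meet# (map (to π) A) (map (act π) X)
  meet#-act π A X = ≤-antisym _ _ act≤meet meet≤act
    where
    act≤meet : act π (meet# A X) ≤ meet# (map (to π) A) (map (act π) X)
    act≤meet = meet#-great _ _ _
      (λ c c∈ → let (c₀ , c₀∈ , e) = ∈-map⁻ (to π) c∈
                in subst (_# _) (sym e) (NL.#-act π (meet#-fresh A X c₀ c₀∈)))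
      (λ x' x'∈ → let (x , x∈ , e) = ∈-map⁻ (act π) x'∈
                  in subst (_ ≤_) (sym e) (≤-eqv π _ _ (meet#-lb A X x x∈)))
    m = meet# (map (to π) A) (map (act π) X)
    inv-m≤ : act (invP π) m ≤ meet# A X
    inv-m≤ = meet#-great _ _ _
      (λ c c∈ → subst (_# act (invP π) m) (Perm.from-to π c)
                  (NL.#-act (invP π) (meet#-fresh _ _ (to π c) (∈-map⁺ (to π) c∈))))
      (λ x x∈ → ≤-eqv (invP π) _ _ (meet#-lb _ _ (act π x) (∈-map⁺ (act π) x∈))
                ⟨≤⟩ ≡⇒≤ (NL.act-invʳ π x))
    meet≤act : m ≤ act π (meet# A X)
    meet≤act = ≡⇒≤ (sym (NL.act-invˡ π m)) ⟨≤⟩ ≤-eqv π _ _ inv-m≤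

  join#-act : ∀ π A X → act π (join# A X) ≡ join# (map (to π) A) (map (act π) X)
  join#-act π A X = ≤-antisym _ _ act≤join join≤act
    where
    join≤act : join# (map (to π) A) (map (act π) X) ≤ act π (join# A X)
    join≤act = join#-least _ _ _
      (λ c c∈ → let (c₀ , c₀∈ , e) = ∈-map⁻ (to π) c∈
                in subst (_# _) (sym e) (NL.#-act π (join#-fresh A X c₀ c₀∈)))
      (λ x' x'∈ → let (x , x∈ , e) = ∈-map⁻ (act π) x'∈
                  in subst (_≤ _) (sym e) (≤-eqv π _ _ (join#-ub A X x x∈)))
    j = join# (map (to π) A) (map (act π) X)
    join≤inv-j : join# A X ≤ act (invP π) j
    join≤inv-j = join#-least _ _ _
      (λ c c∈ → subst (_# act (invP π) j) (Perm.from-to π c)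
                  (NL.#-act (invP π) (join#-fresh _ _ (to π c) (∈-map⁺ (to π) c∈))))
      (λ x x∈ → ≡⇒≤ (sym (NL.act-invʳ π x))
                ⟨≤⟩ ≤-eqv (invP π) _ _ (join#-ub _ _ (act π x) (∈-map⁺ (act π) x∈)))
    act≤join : act π (join# A X) ≤ j
    act≤join = ≤-eqv π _ _ join≤inv-j ⟨≤⟩ ≡⇒≤ (NL.act-invˡ π j)

  -- Complementation is equivariant, since complements are unique.
  ¬-act : ∀ π x → act π (¬ x) ≡ (¬ (act π x))
  ¬-act π x = compl-unique (act π x) (act π (¬ x))
    (trans (sym (meet#-act π [] (x ∷ ¬ x ∷ []))) (trans (cong (act π) (∧-compl x)) (join#-act π [] [])))
    (trans (sym (join#-act π [] (x ∷ ¬ x ∷ []))) (trans (cong (act π) (∨-compl x)) (meet#-act π [] [])))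

  meet#-fresh-∉ : ∀ c A X → c ∉ A → (∀ x → x ∈ X → c # x) → c # meet# A X
  meet#-fresh-∉ c A X c∉A c#X =
    NL.fresh-by-swap _ c b (λ b∈ → b∉ (there (∈-++⁺ˡ b∈)))
      (trans (meet#-act (swapP c b) A X) (cong₂ meet#
        (map-id-local (All.tabulate (λ {d} d∈ →
           swapA-other c b d (λ e → c∉A (subst (_∈ A) e d∈))
                             (λ e → b∉ (there (∈-++⁺ʳ (suppL (meet# A X)) (∈-++⁺ˡ (subst (_∈ A) e d∈))))))))
        (map-id-local (All.tabulate (λ {x} x∈ → NL.swap-fresh (c#X x x∈)
           (NL.∉suppL⇒# (λ b∈ → b∉ (there (∈-++⁺ʳ (suppL (meet# A X)) (∈-++⁺ʳ A (∈-concatMap suppL X b∈ x∈)))))))))))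
    where
    avoid = c ∷ suppL (meet# A X) ++ A ++ concatMap suppL X
    b = fresh avoid
    b∉ = fresh-∉ avoid

  join#-fresh-∉ : ∀ c A X → c ∉ A → (∀ x → x ∈ X → c # x) → c # join# A X
  join#-fresh-∉ c A X c∉A c#X =
    NL.fresh-by-swap _ c b (λ b∈ → b∉ (there (∈-++⁺ˡ b∈)))
      (trans (join#-act (swapP c b) A X) (cong₂ join#
        (map-id-local (All.tabulate (λ {d} d∈ →
           swapA-other c b d (λ e → c∉A (subst (_∈ A) e d∈))
                             (λ e → b∉ (there (∈-++⁺ʳ (suppL (join# A X)) (∈-++⁺ˡ (subst (_∈ A) e d∈))))))))
        (map-id-local (All.tabulate (λ {x} x∈ → NL.swap-fresh (c#X x x∈)
           (NL.∉suppL⇒# (λ b∈ → b∉ (there (∈-++⁺ʳ (suppL (join# A X)) (∈-++⁺ʳ A (∈-concatMap suppL X b∈ x∈)))))))))))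
    where
    avoid = c ∷ suppL (join# A X) ++ A ++ concatMap suppL X
    b = fresh avoid
    b∉ = fresh-∉ avoid

  ¬-fresh : ∀ c x → c # x → c # (¬ x)
  ¬-fresh c x c#x =
    NL.fresh-by-swap _ c b (λ b∈ → b∉ (there (∈-++⁺ˡ b∈)))
      (trans (¬-act (swapP c b) x)
             (cong ¬_ (NL.swap-fresh c#x (NL.∉suppL⇒# (λ b∈ → b∉ (there (∈-++⁺ʳ (suppL (¬ x)) b∈)))))))
    where
    avoid = c ∷ suppL (¬ x) ++ suppL x
    b = fresh avoid
    b∉ = fresh-∉ avoid

  -- Substitution is monotone, because it preserves binary meets.
  sub-mono : ∀ {x y} a u → x ≤ y → subL x a u ≤ subL y a u
  sub-mono {x} {y} a u x≤y =
    ≡⇒≤ (cong (λ z → subL z a u) (≤-antisym _ _ (∧-greatest (≤-refl x) x≤y) ∧-≤ˡ))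
    ⟨≤⟩ ≡⇒≤ (compat-meet [] (x ∷ y ∷ []) a u (λ _ ()))
    ⟨≤⟩ ∧-≤ʳ

  ⋀-antitone : ∀ {X X'} → (∀ x → x ∈ X → x ∈ X') → ⋀ X' ≤ ⋀ X
  ⋀-antitone X⊆X' = ⋀-greatest (λ x x∈ → ⋀-lb (X⊆X' x x∈))

  ⋁-monotone : ∀ {Y Y'} → (∀ y → y ∈ Y → y ∈ Y') → ⋁ Y ≤ ⋁ Y'
  ⋁-monotone Y⊆Y' = ⋁-least (λ y y∈ → ⋁-ub (Y⊆Y' y y∈))

  hyp-valid : ∀ {x X Y} → ⋀ (x ∷ X) ≤ ⋁ (x ∷ Y)
  hyp-valid = ⋀-lb (here refl) ⟨≤⟩ ⋁-ub (here refl)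

  ⊥L-valid : ∀ {X Y} → ⋀ (⊥ ∷ X) ≤ ⋁ Y
  ⊥L-valid = ⋀-lb (here refl) ⟨≤⟩ ⊥-≤

  ∧L-valid : ∀ {x y X Y} → ⋀ (x ∷ y ∷ X) ≤ ⋁ Y → ⋀ ((x ∧ y) ∷ X) ≤ ⋁ Y
  ∧L-valid premise =
    ⋀-greatest (λ { _ (here refl) → ⋀-lb (here refl) ⟨≤⟩ ∧-≤ˡ
                  ; _ (there (here refl)) → ⋀-lb (here refl) ⟨≤⟩ ∧-≤ʳ
                  ; _ (there (there z∈)) → ⋀-lb (there z∈) })
    ⟨≤⟩ premise

  ∧R-valid : ∀ {x y X Y} → ⋀ X ≤ ⋁ (x ∷ Y) → ⋀ X ≤ ⋁ (y ∷ Y) → ⋀ X ≤ ⋁ ((x ∧ y) ∷ Y)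
  ∧R-valid {x} {y} {X} {Y} premise₁ premise₂ =
    ∧-greatest (premise₁ ⟨≤⟩ ⋁-cons-≤) (premise₂ ⟨≤⟩ ⋁-cons-≤)
    ⟨≤⟩ distrib-≤ (⋁ Y) x y
    ⟨≤⟩ ⋁-cons-≥

  ¬L-valid : ∀ {x X Y} → ⋀ X ≤ ⋁ (x ∷ Y) → ⋀ ((¬ x) ∷ X) ≤ ⋁ Y
  ¬L-valid {x} {X} {Y} premise =
    ∧-greatest (⋀-antitone (λ _ → there) ⟨≤⟩ premise ⟨≤⟩ ⋁-cons-≤) (⋀-lb (here refl) ⟨≤⟩ ∨-≥ʳ)
    ⟨≤⟩ distrib-≤ (⋁ Y) x (¬ x)
    ⟨≤⟩ ∨-least (≤-refl (⋁ Y)) (≡⇒≤ (∧-compl x) ⟨≤⟩ ⊥-≤)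

  ¬R-valid : ∀ {x X Y} → ⋀ (x ∷ X) ≤ ⋁ Y → ⋀ X ≤ ⋁ ((¬ x) ∷ Y)
  ¬R-valid {x} {X} {Y} premise =
    ∧-greatest (≤-⊤ ⟨≤⟩ ⊤-≤-¬∨) ∨-≥ʳ
    ⟨≤⟩ distrib-≤ (¬ x) x (⋀ X)
    ⟨≤⟩ ∨-least (⋁-ub (here refl))
                (⋀-greatest (λ { _ (here refl) → ∧-≤ˡ ; _ (there z∈) → ∧-≤ʳ ⟨≤⟩ ⋀-lb z∈ })
                 ⟨≤⟩ premise ⟨≤⟩ ⋁-monotone (λ _ → there))

  ∀R-valid : ∀ {a y X Y} → a # ⋀ X → a # ⋁ Y → ⋀ X ≤ ⋁ (y ∷ Y) →
             ⋀ X ≤ ⋁ (meet# (a ∷ []) (y ∷ []) ∷ Y)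
  ∀R-valid {a} {y} {X} {Y} a#X a#Y premise =
    meet#-great (a ∷ []) (_ ∷ []) _ (λ { _ (here refl) → a#X })
                (λ { _ (here refl) → premise ⟨≤⟩ ⋁-cons-≤ })
    ⟨≤⟩ ≡⇒≤ (sym (distrib# (⋁ Y) y a a#Y))
    ⟨≤⟩ ⋁-cons-≥

_⊆_∪_ : List Atom → List Atom → List Atom → Set
xs ⊆ ys ∪ zs = ∀ {c} → c ∈ xs → c ∈ ys ⊎ c ∈ zs

++-⊆∪ : ∀ {xs xs' ys ys' zs} → xs ⊆ xs' ∪ zs → ys ⊆ ys' ∪ zs → (xs ++ ys) ⊆ (xs' ++ ys') ∪ zs
++-⊆∪ {xs} {xs'} xs⊆ ys⊆ c∈ with ∈-++⁻ xs c∈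
... | inj₁ c∈xs with xs⊆ c∈xs
...   | inj₁ c∈xs' = inj₁ (∈-++⁺ˡ c∈xs')
...   | inj₂ c∈zs = inj₂ c∈zs
++-⊆∪ {xs} {xs'} xs⊆ ys⊆ c∈ | inj₂ c∈ys with ys⊆ c∈ys
...   | inj₁ c∈ys' = inj₁ (∈-++⁺ʳ xs' c∈ys')
...   | inj₂ c∈zs = inj₂ c∈zs

_⊆_∖_ : List Atom → List Atom → Atom → Set
xs ⊆ ys ∖ a = ∀ {c} → c ∈ xs → c ∈ ys × c ≢ a

++-⊆∖ : ∀ {xs xs' ys ys' a} → xs ⊆ xs' ∖ a → ys ⊆ ys' ∖ a → (xs ++ ys) ⊆ (xs' ++ ys') ∖ a
++-⊆∖ {xs} {xs'} xs⊆ ys⊆ c∈ with ∈-++⁻ xs c∈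
... | inj₁ c∈xs = let (c∈xs' , c≢a) = xs⊆ c∈xs in ∈-++⁺ˡ c∈xs' , c≢a
... | inj₂ c∈ys = let (c∈ys' , c≢a) = ys⊆ c∈ys in ∈-++⁺ʳ xs' c∈ys' , c≢a

module FreeAtoms (S : Signature) where
  open Signature S
  open Syntax S

  mutual
    fv-wk : ∀ {n} (r : Term 0) → fvT (wk {n} r) ≡ fvT r
    fv-wk (bvar ())
    fv-wk (fvar a) = refl
    fv-wk (app f ts) = fv-wks ts

    fv-wks : ∀ {n k} (ts : V.Vec (Term 0) k) → fvTs (wks {n} ts) ≡ fvTs ts
    fv-wks V.[] = refl
    fv-wks (t V.∷ ts) = cong₂ _++_ (fv-wk t) (fv-wks ts)

  mutual
    fv-substT : ∀ {n} (t : Term n) a r → fvT (substT t a r) ⊆ fvT t ∪ fvT r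
    fv-substT (bvar i) a r ()
    fv-substT (fvar b) a r c∈ with b ≟ a
    ... | yes _ = inj₂ (subst (_ ∈_) (fv-wk r) c∈)
    ... | no _ = inj₁ c∈
    fv-substT (app f ts) a r c∈ = fv-substTs ts a r c∈

    fv-substTs : ∀ {n k} (ts : V.Vec (Term n) k) a r → fvTs (substTs ts a r) ⊆ fvTs ts ∪ fvT r
    fv-substTs V.[] a r ()
    fv-substTs (t V.∷ ts) a r = ++-⊆∪ {fvT (substT t a r)} (fv-substT t a r) (fv-substTs ts a r)

  fv-substF : ∀ {n} (φ : Form n) a r → fvF (substF φ a r) ⊆ fvF φ ∪ fvT r
  fv-substF ⊥f a r ()
  fv-substF (s ≐ t) a r = ++-⊆∪ {fvT (substT s a r)} (fv-substT s a r) (fv-substT t a r)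
  fv-substF (pred P ts) a r = fv-substTs ts a r
  fv-substF (φ ∧f ψ) a r = ++-⊆∪ {fvF (substF φ a r)} (fv-substF φ a r) (fv-substF ψ a r)
  fv-substF (¬f φ) a r = fv-substF φ a r
  fv-substF (∀f φ) a r = fv-substF φ a r

  mutual
    fv-absT : ∀ {n} a (t : Term n) → fvT (absT a t) ⊆ fvT t ∖ a
    fv-absT a (bvar i) ()
    fv-absT a (fvar b) c∈ with b ≟ a
    fv-absT a (fvar b) () | yes _
    fv-absT a (fvar b) (here refl) | no b≢a = here refl , b≢a
    fv-absT a (app f ts) = fv-absTs a ts

    fv-absTs : ∀ {n k} a (ts : V.Vec (Term n) k) → fvTs (absTs a ts) ⊆ fvTs ts ∖ a
    fv-absTs a V.[] ()
    fv-absTs a (t V.∷ ts) = ++-⊆∖ {fvT (absT a t)} (fv-absT a t) (fv-absTs a ts)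

  fv-absF : ∀ {n} a (φ : Form n) → fvF (absF a φ) ⊆ fvF φ ∖ a
  fv-absF a ⊥f ()
  fv-absF a (s ≐ t) = ++-⊆∖ {fvT (absT a s)} (fv-absT a s) (fv-absT a t)
  fv-absF a (pred P ts) = fv-absTs a ts
  fv-absF a (φ ∧f ψ) = ++-⊆∖ {fvF (absF a φ)} (fv-absF a φ) (fv-absF a ψ)
  fv-absF a (¬f φ) = fv-absF a φ
  fv-absF a (∀f φ) = fv-absF a φ

-- Bookkeeping for environments extended at the end (ρ ∷ʳ a), which is how
-- abstraction absF turns a into the outermost bound variable.
lookup-∷ʳ-inject₁ : ∀ {A : Set} {n} (ρ : Vec A n) a i → V.lookup (ρ V.∷ʳ a) (inject₁ i) ≡ V.lookup ρ i
lookup-∷ʳ-inject₁ (x V.∷ ρ) a zero = refl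
lookup-∷ʳ-inject₁ (x V.∷ ρ) a (suc i) = lookup-∷ʳ-inject₁ ρ a i

lookup-∷ʳ-last : ∀ {A : Set} {n} (ρ : Vec A n) a → V.lookup (ρ V.∷ʳ a) (fromℕ n) ≡ a
lookup-∷ʳ-last V.[] a = refl
lookup-∷ʳ-last (x V.∷ ρ) a = lookup-∷ʳ-last ρ a

∉-∷ʳ : ∀ {A : Set} {n} (ρ : Vec A n) a {c} → c ≢ a → c ∉ toList ρ → c ∉ toList (ρ V.∷ʳ a)
∉-∷ʳ V.[] a c≢a c∉ρ (here e) = c≢a e
∉-∷ʳ (x V.∷ ρ) a c≢a c∉ρ (here e) = c∉ρ (here e)
∉-∷ʳ (x V.∷ ρ) a c≢a c∉ρ (there c∈) = ∉-∷ʳ ρ a c≢a (λ c∈ρ → c∉ρ (there c∈ρ)) c∈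

module Soundness (T : Termlike) (𝓛 : FOLeq T) (S : Signature) (I : Interpretation T 𝓛 S) where
  open Termlike T using (UN; U; subU; atm; atm-eqv; σ-atm) renaming (act to actU; _#_ to _#U_; suppL to suppU)
  open FOLeq 𝓛
  open Signature S
  open Interpretation I
  open Syntax S
  open Semantics I
  open LatticeFacts T 𝓛
  open FreeAtoms S
  private
    module DU = SubstDefined T UN subU (Termlike.isσ T)
    module DL = SubstDefined T LN subL isσL
    module NU = NominalFacts UN
    module NL = NominalFacts LN
    module σU = IsSigmaAlg (Termlike.isσ T)
    module σL = IsSigmaAlg isσL
    module ΣL = SigmaFacts T LN subL isσL

  module FunOp (f : Fun) = DU.PresentationFacts (DU.EquivariantFamily.presentation (fI f) (fI-eqv f))
  module PredOp (P : Pred) = DL.PresentationFacts (DL.EquivariantFamily.presentation (pI P) (pI-eqv P))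

  -- So is equality u =^I v = (a =^L b)[a:=u, b:=v]: its body is (a =^L b)
  -- renamed to admissible targets ks (distinct and apart from a, b).
  module EqOp where
    ab : Vec Atom 2
    ab = eqA V.∷ eqB V.∷ V.[]

    ab-nodup : Nodup ab
    ab-nodup = (λ { (here e) → eqA≢eqB e ; (there ()) }) , (λ ()) , Unit.tt

    Admissible : Vec Atom 2 → Set
    Admissible ks = Nodup ks × Apart ks ab

    body : (ks : Vec Atom 2) → Admissible ks → L
    body ks adm = act (renP ab ks) eqL

    renP-ab : ∀ ks (adm : Admissible ks) → V.map (to (renP ab ks)) ab ≡ ks
    renP-ab ks adm = renP-map ab ks ab-nodup (proj₁ adm) (proj₂ adm)

    eqOp : Vec U 2 → L
    eqOp (u V.∷ v V.∷ V.[]) = u =I v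

    presented : ∀ us → Σ (Vec Atom 2) λ ks → Σ (Admissible ks) λ adm →
                ΣL.AllFresh ks us × (eqOp us ≡ ΣL.seqSub (body ks adm) ks us)
    presented (u V.∷ v V.∷ V.[]) =
      targets , (nodup , apart) , fresh-us ,
      trans unfolds (cong (λ z → ΣL.seqSub z targets (u V.∷ v V.∷ V.[]))
        (NL.act-agree _ _ eqL-supp (map-≡⇒pointwise _ _ ab (trans maps (sym (renP-ab targets (nodup , apart)))))))
      where open ΣL.Unfolding (ΣL.simSubst-unfold eqL ab (u V.∷ v V.∷ V.[]) ab-nodup)

    presentation : DL.Presentation eqOp
    presentation = record
      { Admissible   = Admissible
      ; body         = body
      ; adm-nodup    = λ ks adm → proj₁ adm
      ; body-supp    = λ ks adm → subst (λ A → Supports act A (body ks adm))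
                         (trans (sym (toList-map (to (renP ab ks)) ab)) (cong toList (renP-ab ks adm)))
                         (NL.supports-act (renP ab ks) eqL-supp)
      ; body-rename  = λ ks adm ks' adm' apart →
          trans (sym (act-∘ (renP ks ks') (renP ab ks) eqL))
            (NL.act-agree _ _ eqL-supp (map-≡⇒pointwise _ _ ab
              (trans (map-∘ (to (renP ks ks')) (to (renP ab ks)) ab)
                (trans (cong (V.map (to (renP ks ks'))) (renP-ab ks adm))
                  (trans (renP-map ks ks' (proj₁ adm) (proj₁ adm') apart) (sym (renP-ab ks' adm')))))))
      ; adm-avoiding = λ avoid →
          freshRun 2 (eqA ∷ eqB ∷ avoid) ,
          (run-nodup 2 _ , λ c c∈ c∈ab → freshRun-∉ 2 (eqA ∷ eqB ∷ avoid) c c∈ (ab⊆ c∈ab)) ,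
          λ c c∈ c∈avoid → freshRun-∉ 2 (eqA ∷ eqB ∷ avoid) c c∈ (there (there c∈avoid))
      ; presented    = presented
      }
      where
      ab⊆ : ∀ {c avoid} → c ∈ toList ab → c ∈ eqA ∷ eqB ∷ avoid
      ab⊆ (here e) = here e
      ab⊆ (there (here e)) = there (here e)

    open DL.PresentationFacts presentation public

  atm-fresh : ∀ c a → c ≢ a → c #U atm a
  atm-fresh c a c≢a =
    NU.fresh-by-swap (atm a) c b (λ b∈ → b∉ (there (there b∈)))
      (trans (atm-eqv (swapP c b) a) (cong atm (swapA-other c b a (≢-sym c≢a) (λ e → b∉ (there (here (sym e)))))))
    where
    avoid = c ∷ a ∷ suppU (atm a)
    b = fresh avoid
    b∉ = fresh-∉ avoid

  mutual
    term-fresh : ∀ {n} (t : Term n) (ρ : Vec Atom n) c → c ∉ fvT t → c ∉ toList ρ → c #U ⟦ t ⟧t ρ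
    term-fresh (bvar i) ρ c _ c∉ρ = atm-fresh c _ (λ e → c∉ρ (subst (_∈ toList ρ) (sym e) (∈-lookup ρ i)))
    term-fresh (fvar a) ρ c c∉ _ = atm-fresh c a (λ e → c∉ (here e))
    term-fresh (app f ts) ρ c c∉ c∉ρ = FunOp.op-fresh f c (⟦ ts ⟧ts ρ) (terms-fresh ts ρ c c∉ c∉ρ)

    terms-fresh : ∀ {n k} (ts : Vec (Term n) k) (ρ : Vec Atom n) c → c ∉ fvTs ts → c ∉ toList ρ →
                  ∀ u → u ∈ toList (⟦ ts ⟧ts ρ) → c #U u
    terms-fresh (t V.∷ ts) ρ c c∉ c∉ρ u (here refl) = term-fresh t ρ c (λ c∈ → c∉ (∈-++⁺ˡ c∈)) c∉ρ
    terms-fresh (t V.∷ ts) ρ c c∉ c∉ρ u (there u∈) = terms-fresh ts ρ c (λ c∈ → c∉ (∈-++⁺ʳ (fvT t) c∈)) c∉ρ u u∈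

  form-fresh : ∀ {n} (φ : Form n) (ρ : Vec Atom n) c → c ∉ fvF φ → c ∉ toList ρ → c # ⟦ φ ⟧f ρ
  form-fresh ⊥f ρ c _ _ = join#-fresh-∉ c [] [] (λ ()) (λ _ ())
  form-fresh (r ≐ s) ρ c c∉ c∉ρ = EqOp.op-fresh c (⟦ r ⟧t ρ V.∷ ⟦ s ⟧t ρ V.∷ V.[])
    (λ { _ (here refl) → term-fresh r ρ c (λ c∈ → c∉ (∈-++⁺ˡ c∈)) c∉ρ
       ; _ (there (here refl)) → term-fresh s ρ c (λ c∈ → c∉ (∈-++⁺ʳ (fvT r) c∈)) c∉ρ })
  form-fresh (pred P ts) ρ c c∉ c∉ρ = PredOp.op-fresh P c (⟦ ts ⟧ts ρ) (terms-fresh ts ρ c c∉ c∉ρ)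
  form-fresh (φ ∧f ψ) ρ c c∉ c∉ρ = meet#-fresh-∉ c [] _ (λ ())
    (λ { _ (here refl) → form-fresh φ ρ c (λ c∈ → c∉ (∈-++⁺ˡ c∈)) c∉ρ
       ; _ (there (here refl)) → form-fresh ψ ρ c (λ c∈ → c∉ (∈-++⁺ʳ (fvF φ) c∈)) c∉ρ })
  form-fresh (¬f φ) ρ c c∉ c∉ρ = ¬-fresh c _ (form-fresh φ ρ c c∉ c∉ρ)
  form-fresh (∀f φ) ρ c c∉ c∉ρ with c ≟ fresh (fvF φ ++ toList ρ)
  ... | yes c≡b = meet#-fresh (_ ∷ []) _ c (here c≡b)
  ... | no c≢b = meet#-fresh-∉ c (_ ∷ []) _ (λ { (here e) → c≢b e })
    (λ { _ (here refl) → form-fresh φ (_ V.∷ ρ) c c∉ (λ { (here e) → c≢b e ; (there c∈) → c∉ρ c∈ }) })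

  SwapInvariant : ∀ {n} → Form n → Set
  SwapInvariant {n} φ = ∀ (ρ : Vec Atom n) a b → a ∉ fvF φ → b ∉ fvF φ →
                        act (swapP a b) (⟦ φ ⟧f ρ) ≡ ⟦ φ ⟧f (V.map (swapA a b) ρ)

  fresh-binder : ∀ {n} (φ : Form (suc n)) (ρ : Vec Atom n) b → SwapInvariant φ →
                 b ∉ fvF φ → b ∉ toList ρ → ⟦ ∀f φ ⟧f ρ ≡ meet# (b ∷ []) (⟦ φ ⟧f (b V.∷ ρ) ∷ [])
  fresh-binder φ ρ b invariant b∉φ b∉ρ =
    begin
      meet# (c ∷ []) (y ∷ [])
        ≡⟨ sym (NL.swap-fresh (meet#-fresh (c ∷ []) (y ∷ []) c (here refl)) b#meet) ⟩
      act (swapP c b) (meet# (c ∷ []) (y ∷ []))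
        ≡⟨ meet#-act (swapP c b) (c ∷ []) (y ∷ []) ⟩
      meet# (swapA c b c ∷ []) (act (swapP c b) y ∷ [])
        ≡⟨ cong₂ (λ d z → meet# (d ∷ []) (z ∷ [])) (swapA-a c b)
                 (invariant (c V.∷ ρ) c b c∉φ b∉φ) ⟩
      meet# (b ∷ []) (⟦ φ ⟧f (swapA c b c V.∷ V.map (swapA c b) ρ) ∷ [])
        ≡⟨ cong (λ ρ' → meet# (b ∷ []) (⟦ φ ⟧f ρ' ∷ []))
                (cong₂ V._∷_ (swapA-a c b) (map-id-on (swapA c b) ρ (λ d d∈ →
                   swapA-other c b d (λ e → c∉ (∈-++⁺ʳ (fvF φ) (subst (_∈ toList ρ) e d∈)))
                                     (λ e → b∉ρ (subst (_∈ toList ρ) e d∈))))) ⟩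
      meet# (b ∷ []) (⟦ φ ⟧f (b V.∷ ρ) ∷ []) ∎
    where
    open ≡-Reasoning
    c = fresh (fvF φ ++ toList ρ)
    c∉ = fresh-∉ (fvF φ ++ toList ρ)
    c∉φ : c ∉ fvF φ
    c∉φ c∈ = c∉ (∈-++⁺ˡ c∈)
    y = ⟦ φ ⟧f (c V.∷ ρ)
    b#meet : b # meet# (c ∷ []) (y ∷ [])
    b#meet with b ≟ c
    ... | yes b≡c = meet#-fresh (c ∷ []) (y ∷ []) b (here b≡c)
    ... | no b≢c = meet#-fresh-∉ b (c ∷ []) (y ∷ []) (λ { (here e) → b≢c e })
      (λ { _ (here refl) → form-fresh φ (c V.∷ ρ) b b∉φ (λ { (here e) → b≢c e ; (there b∈) → b∉ρ b∈ }) })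

  -- Swap invariance, by induction on terms and formulas; the quantifier case
  -- uses fresh-binder for the (smaller) body.
  mutual
    term-swap : ∀ {n} (t : Term n) (ρ : Vec Atom n) a b → a ∉ fvT t → b ∉ fvT t →
                actU (swapP a b) (⟦ t ⟧t ρ) ≡ ⟦ t ⟧t (V.map (swapA a b) ρ)
    term-swap (bvar i) ρ a b _ _ =
      trans (atm-eqv (swapP a b) (V.lookup ρ i)) (cong atm (sym (lookup-map i (swapA a b) ρ)))
    term-swap (fvar c) ρ a b a∉ b∉ =
      trans (atm-eqv (swapP a b) c) (cong atm (swapA-other a b c (λ e → a∉ (here (sym e))) (λ e → b∉ (here (sym e)))))
    term-swap (app f ts) ρ a b a∉ b∉ =
      trans (FunOp.op-swap f a b (⟦ ts ⟧ts ρ)) (cong (fExt f) (terms-swap ts ρ a b a∉ b∉))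

    terms-swap : ∀ {n k} (ts : Vec (Term n) k) (ρ : Vec Atom n) a b → a ∉ fvTs ts → b ∉ fvTs ts →
                 V.map (actU (swapP a b)) (⟦ ts ⟧ts ρ) ≡ ⟦ ts ⟧ts (V.map (swapA a b) ρ)
    terms-swap V.[] ρ a b _ _ = refl
    terms-swap (t V.∷ ts) ρ a b a∉ b∉ =
      cong₂ V._∷_ (term-swap t ρ a b (λ a∈ → a∉ (∈-++⁺ˡ a∈)) (λ b∈ → b∉ (∈-++⁺ˡ b∈)))
                  (terms-swap ts ρ a b (λ a∈ → a∉ (∈-++⁺ʳ (fvT t) a∈)) (λ b∈ → b∉ (∈-++⁺ʳ (fvT t) b∈)))

  swap-invariant : ∀ {n} (φ : Form n) → SwapInvariant φ
  swap-invariant ⊥f ρ a b _ _ = join#-act (swapP a b) [] []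
  swap-invariant (r ≐ s) ρ a b a∉ b∉ =
    trans (EqOp.op-swap a b (⟦ r ⟧t ρ V.∷ ⟦ s ⟧t ρ V.∷ V.[]))
          (cong₂ _=I_ (term-swap r ρ a b (λ a∈ → a∉ (∈-++⁺ˡ a∈)) (λ b∈ → b∉ (∈-++⁺ˡ b∈)))
                      (term-swap s ρ a b (λ a∈ → a∉ (∈-++⁺ʳ (fvT r) a∈)) (λ b∈ → b∉ (∈-++⁺ʳ (fvT r) b∈))))
  swap-invariant (pred P ts) ρ a b a∉ b∉ =
    trans (PredOp.op-swap P a b (⟦ ts ⟧ts ρ)) (cong (pExt P) (terms-swap ts ρ a b a∉ b∉))
  swap-invariant (φ ∧f ψ) ρ a b a∉ b∉ =
    trans (meet#-act (swapP a b) [] (⟦ φ ⟧f ρ ∷ ⟦ ψ ⟧f ρ ∷ []))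
          (cong₂ _∧_ (swap-invariant φ ρ a b (λ a∈ → a∉ (∈-++⁺ˡ a∈)) (λ b∈ → b∉ (∈-++⁺ˡ b∈)))
                     (swap-invariant ψ ρ a b (λ a∈ → a∉ (∈-++⁺ʳ (fvF φ) a∈)) (λ b∈ → b∉ (∈-++⁺ʳ (fvF φ) b∈))))
  swap-invariant (¬f φ) ρ a b a∉ b∉ = trans (¬-act (swapP a b) (⟦ φ ⟧f ρ)) (cong ¬_ (swap-invariant φ ρ a b a∉ b∉))
  swap-invariant (∀f φ) ρ a b a∉ b∉ =
    trans (meet#-act (swapP a b) (c ∷ []) (⟦ φ ⟧f (c V.∷ ρ) ∷ []))
      (trans (cong (λ z → meet# (c' ∷ []) (z ∷ [])) (swap-invariant φ (c V.∷ ρ) a b a∉ b∉))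
             (sym (fresh-binder φ (V.map (swapA a b) ρ) c' (swap-invariant φ) c'∉φ c'∉ρ)))
    where
    c = fresh (fvF φ ++ toList ρ)
    c∉ = fresh-∉ (fvF φ ++ toList ρ)
    c' = swapA a b c
    -- c' ∉ {a, b} when it is free in φ, so it is fixed by (a b) and equals c.
    c'∉φ : c' ∉ fvF φ
    c'∉φ c'∈ = c∉ (∈-++⁺ˡ (subst (_∈ fvF φ) c'≡c c'∈))
      where
      c'≡c : c' ≡ c
      c'≡c = trans (sym (swapA-other a b c' (λ e → a∉ (subst (_∈ fvF φ) e c'∈)) (λ e → b∉ (subst (_∈ fvF φ) e c'∈))))
                   (swapA-invol a b c)
    c'∉ρ : c' ∉ toList (V.map (swapA a b) ρ)
    c'∉ρ c'∈ = let (d , d∈ , e) = ∈-toList-map⁻ (swapA a b) ρ c'∈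
               in c∉ (∈-++⁺ʳ (fvF φ) (subst (_∈ toList ρ) (sym (to-injective (swapP a b) e)) d∈))

  mutual
    term-wk : ∀ {n} (r : Term 0) (ρ : Vec Atom n) → ⟦ wk r ⟧t ρ ≡ ⟦ r ⟧t V.[]
    term-wk (bvar ()) ρ
    term-wk (fvar a) ρ = refl
    term-wk (app f ts) ρ = cong (fExt f) (terms-wk ts ρ)

    terms-wk : ∀ {n k} (ts : Vec (Term 0) k) (ρ : Vec Atom n) → ⟦ wks ts ⟧ts ρ ≡ ⟦ ts ⟧ts V.[]
    terms-wk V.[] ρ = refl
    terms-wk (t V.∷ ts) ρ = cong₂ V._∷_ (term-wk t ρ) (terms-wk ts ρ)

  mutual
    term-subst : ∀ {n} (t : Term n) (ρ : Vec Atom n) a r → a ∉ toList ρ →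
                 ⟦ substT t a r ⟧t ρ ≡ subU (⟦ t ⟧t ρ) a (⟦ r ⟧t V.[])
    term-subst (bvar i) ρ a r a∉ρ =
      sym (σU.σ-# _ a _ (atm-fresh a _ (λ e → a∉ρ (subst (_∈ toList ρ) (sym e) (∈-lookup ρ i)))))
    term-subst (fvar b) ρ a r a∉ρ with b ≟ a
    ... | yes refl = trans (term-wk r ρ) (sym (σ-atm b (⟦ r ⟧t V.[])))
    ... | no b≢a = sym (σU.σ-# (atm b) a _ (atm-fresh a b (≢-sym b≢a)))
    term-subst (app f ts) ρ a r a∉ρ =
      trans (cong (fExt f) (terms-subst ts ρ a r a∉ρ)) (sym (FunOp.op-sub f a (⟦ r ⟧t V.[]) (⟦ ts ⟧ts ρ)))

    terms-subst : ∀ {n k} (ts : Vec (Term n) k) (ρ : Vec Atom n) a r → a ∉ toList ρ →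
                  ⟦ substTs ts a r ⟧ts ρ ≡ V.map (λ u → subU u a (⟦ r ⟧t V.[])) (⟦ ts ⟧ts ρ)
    terms-subst V.[] ρ a r a∉ρ = refl
    terms-subst (t V.∷ ts) ρ a r a∉ρ = cong₂ V._∷_ (term-subst t ρ a r a∉ρ) (terms-subst ts ρ a r a∉ρ)

  form-subst : ∀ {n} (φ : Form n) (ρ : Vec Atom n) a r → a ∉ toList ρ →
               ⟦ substF φ a r ⟧f ρ ≡ subL (⟦ φ ⟧f ρ) a (⟦ r ⟧t V.[])
  form-subst ⊥f ρ a r a∉ρ = sym (compat-join [] [] a _ (λ _ ()))
  form-subst (s ≐ t) ρ a r a∉ρ =
    trans (cong₂ _=I_ (term-subst s ρ a r a∉ρ) (term-subst t ρ a r a∉ρ))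
          (sym (EqOp.op-sub a (⟦ r ⟧t V.[]) (⟦ s ⟧t ρ V.∷ ⟦ t ⟧t ρ V.∷ V.[])))
  form-subst (pred P ts) ρ a r a∉ρ =
    trans (cong (pExt P) (terms-subst ts ρ a r a∉ρ)) (sym (PredOp.op-sub P a (⟦ r ⟧t V.[]) (⟦ ts ⟧ts ρ)))
  form-subst (φ ∧f ψ) ρ a r a∉ρ =
    trans (cong₂ _∧_ (form-subst φ ρ a r a∉ρ) (form-subst ψ ρ a r a∉ρ))
          (sym (compat-meet [] (⟦ φ ⟧f ρ ∷ ⟦ ψ ⟧f ρ ∷ []) a _ (λ _ ())))
  form-subst (¬f φ) ρ a r a∉ρ = trans (cong ¬_ (form-subst φ ρ a r a∉ρ)) (sym (compat-¬ _ a _))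
  form-subst (∀f φ) ρ a r a∉ρ =
    begin
      ⟦ ∀f (substF φ a r) ⟧f ρ
        ≡⟨ fresh-binder (substF φ a r) ρ b (swap-invariant (substF φ a r)) b∉φ[r] b∉ρ ⟩
      meet# (b ∷ []) (⟦ substF φ a r ⟧f (b V.∷ ρ) ∷ [])
        ≡⟨ cong (λ z → meet# (b ∷ []) (z ∷ []))
                (form-subst φ (b V.∷ ρ) a r (λ { (here e) → b≢a (sym e) ; (there a∈) → a∉ρ a∈ })) ⟩
      meet# (b ∷ []) (subL (⟦ φ ⟧f (b V.∷ ρ)) a w ∷ [])
        ≡⟨ sym (compat-meet (b ∷ []) (⟦ φ ⟧f (b V.∷ ρ) ∷ []) a w
                  (λ { _ (here refl) → term-fresh r V.[] b b∉r (λ ()) , b≢a })) ⟩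
      subL (meet# (b ∷ []) (⟦ φ ⟧f (b V.∷ ρ) ∷ [])) a w
        ≡⟨ cong (λ z → subL z a w) (sym (fresh-binder φ ρ b (swap-invariant φ) b∉φ b∉ρ)) ⟩
      subL (⟦ ∀f φ ⟧f ρ) a w ∎
    where
    open ≡-Reasoning
    w = ⟦ r ⟧t V.[]
    avoid = a ∷ fvF φ ++ fvT r ++ toList ρ
    b = fresh avoid
    b∉ = fresh-∉ avoid
    b≢a : b ≢ a
    b≢a e = b∉ (here e)
    b∉φ : b ∉ fvF φ
    b∉φ b∈ = b∉ (there (∈-++⁺ˡ b∈))
    b∉r : b ∉ fvT r
    b∉r b∈ = b∉ (there (∈-++⁺ʳ (fvF φ) (∈-++⁺ˡ b∈)))
    b∉ρ : b ∉ toList ρ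
    b∉ρ b∈ = b∉ (there (∈-++⁺ʳ (fvF φ) (∈-++⁺ʳ (fvT r) b∈)))
    b∉φ[r] : b ∉ fvF (substF φ a r)
    b∉φ[r] b∈ with fv-substF φ a r b∈
    ... | inj₁ b∈φ = b∉φ b∈φ
    ... | inj₂ b∈r = b∉r b∈r

  mutual
    term-abs : ∀ {n} a (t : Term n) (ρ : Vec Atom n) → ⟦ absT a t ⟧t (ρ V.∷ʳ a) ≡ ⟦ t ⟧t ρ
    term-abs a (bvar i) ρ = cong atm (lookup-∷ʳ-inject₁ ρ a i)
    term-abs a (fvar b) ρ with b ≟ a
    ... | yes refl = cong atm (lookup-∷ʳ-last ρ b)
    ... | no _ = refl
    term-abs a (app f ts) ρ = cong (fExt f) (terms-abs a ts ρ)

    terms-abs : ∀ {n k} a (ts : Vec (Term n) k) (ρ : Vec Atom n) → ⟦ absTs a ts ⟧ts (ρ V.∷ʳ a) ≡ ⟦ ts ⟧ts ρ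
    terms-abs a V.[] ρ = refl
    terms-abs a (t V.∷ ts) ρ = cong₂ V._∷_ (term-abs a t ρ) (terms-abs a ts ρ)

  form-abs : ∀ {n} a (φ : Form n) (ρ : Vec Atom n) → ⟦ absF a φ ⟧f (ρ V.∷ʳ a) ≡ ⟦ φ ⟧f ρ
  form-abs a ⊥f ρ = refl
  form-abs a (s ≐ t) ρ = cong₂ _=I_ (term-abs a s ρ) (term-abs a t ρ)
  form-abs a (pred P ts) ρ = cong (pExt P) (terms-abs a ts ρ)
  form-abs a (φ ∧f ψ) ρ = cong₂ _∧_ (form-abs a φ ρ) (form-abs a ψ ρ)
  form-abs a (¬f φ) ρ = cong ¬_ (form-abs a φ ρ)
  form-abs a (∀f φ) ρ =
    trans (fresh-binder (absF a φ) (ρ V.∷ʳ a) b (swap-invariant (absF a φ)) (λ b∈ → b∉φ (proj₁ (fv-absF a φ b∈)))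
                        (∉-∷ʳ ρ a (λ e → b∉ (here e)) b∉ρ))
      (trans (cong (λ z → meet# (b ∷ []) (z ∷ [])) (form-abs a φ (b V.∷ ρ)))
             (sym (fresh-binder φ ρ b (swap-invariant φ) b∉φ b∉ρ)))
    where
    avoid = a ∷ fvF φ ++ toList ρ
    b = fresh avoid
    b∉ = fresh-∉ avoid
    b∉φ : b ∉ fvF φ
    b∉φ b∈ = b∉ (there (∈-++⁺ˡ b∈))
    b∉ρ : b ∉ toList ρ
    b∉ρ b∈ = b∉ (there (∈-++⁺ʳ (fvF φ) b∈))

  forall-denotation : ∀ a φ → ⟦ all a φ ⟧ ≡ meet# (a ∷ []) (⟦ φ ⟧ ∷ [])
  forall-denotation a φ =
    trans (fresh-binder (absF a φ) V.[] a (swap-invariant (absF a φ)) (λ a∈ → proj₂ (fv-absF a φ a∈) refl) (λ ()))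
          (cong (λ z → meet# (a ∷ []) (z ∷ [])) (form-abs a φ V.[]))

  =I-subst : ∀ u v z a → ((u =I v) ∧ subL z a u) ≡ ((u =I v) ∧ subL z a v)
  =I-subst u v z a with a ≟ eqA
  ... | yes refl = eqL-subst u v z
  ... | no a≢eqA =
    trans (sym (conjugate u)) (trans (cong (act σ) (eqL-subst (actU σ u) (actU σ v) (act σ z))) (conjugate v))
    where
    σ = swapP eqA a
    -- (eqA a) transports the axiom at eqA to the axiom at a.
    conjugate : ∀ w → act σ ((actU σ u =I actU σ v) ∧ subL (act σ z) eqA (actU σ w)) ≡ ((u =I v) ∧ subL z a w)
    conjugate w =
      trans (meet#-act σ [] _)
        (cong₂ _∧_
          (trans (EqOp.op-swap eqA a (actU σ u V.∷ actU σ v V.∷ V.[]))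
                 (cong₂ _=I_ (NU.act-swap-invol eqA a u) (NU.act-swap-invol eqA a v)))
          (trans (σL.sub-eqv σ (act σ z) eqA (actU σ w))
                 (cong₂ (λ y q → subL y (proj₁ q) (proj₂ q)) (NL.act-swap-invol eqA a z)
                        (cong₂ _,_ (swapA-a eqA a) (NU.act-swap-invol eqA a w)))))

  ⟦_⟧s : List (Form 0) → List L
  ⟦_⟧s = map ⟦_⟧

  ∉fv⇒#-⋀ : ∀ {a Φ} → a ∉ fvFs Φ → a # ⋀ ⟦ Φ ⟧s
  ∉fv⇒#-⋀ {a} {Φ} a∉ = meet#-fresh-∉ a [] _ (λ ()) (λ x x∈ →
    let (φ , φ∈ , e) = ∈-map⁻ ⟦_⟧ x∈
    in subst (a #_) (sym e) (form-fresh φ V.[] a (λ a∈ → a∉ (∈-concatMap fvF Φ a∈ φ∈)) (λ ())))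

  ∉fv⇒#-⋁ : ∀ {a Φ} → a ∉ fvFs Φ → a # ⋁ ⟦ Φ ⟧s
  ∉fv⇒#-⋁ {a} {Φ} a∉ = join#-fresh-∉ a [] _ (λ ()) (λ x x∈ →
    let (φ , φ∈ , e) = ∈-map⁻ ⟦_⟧ x∈
    in subst (a #_) (sym e) (form-fresh φ V.[] a (λ a∈ → a∉ (∈-concatMap fvF Φ a∈ φ∈)) (λ ())))

  -- Instantiation: [[∀a.φ]] ≤ [[φ[a:=r]]], as ⋀^{#a}[[φ]] is a-fresh.
  forall-instance : ∀ a φ r → ⟦ all a φ ⟧ ≤ ⟦ substF φ a r ⟧
  forall-instance a φ r =
    ≡⇒≤ (forall-denotation a φ)
    ⟨≤⟩ ≡⇒≤ (sym (σL.σ-# _ a w (meet#-fresh (a ∷ []) (⟦ φ ⟧ ∷ []) a (here refl))))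
    ⟨≤⟩ sub-mono a w (meet#-lb (a ∷ []) (⟦ φ ⟧ ∷ []) ⟦ φ ⟧ (here refl))
    ⟨≤⟩ ≡⇒≤ (sym (form-subst φ V.[] a r (λ ())))
    where
    w = ⟦ r ⟧t V.[]

  leibniz : ∀ φ a r r' → (⟦ r' ≐ r ⟧ ∧ ⟦ substF φ a r ⟧) ≤ ⟦ substF φ a r' ⟧
  leibniz φ a r r' =
    ≡⇒≤ (cong (λ z → (u =I v) ∧ z) (form-subst φ V.[] a r (λ ())))
    ⟨≤⟩ ≡⇒≤ (sym (=I-subst u v ⟦ φ ⟧ a))
    ⟨≤⟩ ∧-≤ʳ
    ⟨≤⟩ ≡⇒≤ (sym (form-subst φ V.[] a r' (λ ())))
    where
    u = ⟦ r' ⟧t V.[]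
    v = ⟦ r ⟧t V.[]

  soundness : ∀ {Φ Ψ} → Φ ⊢ Ψ → ⋀ ⟦ Φ ⟧s ≤ ⋁ ⟦ Ψ ⟧s
  soundness (set-conv Φ≈Φ' Ψ≈Ψ' d) =
    ⋀-antitone (λ x x∈ → let (φ , φ∈ , e) = ∈-map⁻ ⟦_⟧ x∈ in subst (_∈ _) (sym e) (∈-map⁺ ⟦_⟧ (proj₁ (Φ≈Φ' φ) φ∈)))
    ⟨≤⟩ soundness d
    ⟨≤⟩ ⋁-monotone (λ y y∈ → let (ψ , ψ∈ , e) = ∈-map⁻ ⟦_⟧ y∈ in subst (_∈ _) (sym e) (∈-map⁺ ⟦_⟧ (proj₁ (Ψ≈Ψ' ψ) ψ∈)))
  soundness Hyp = hyp-valid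
  soundness ⊥L = ⊥L-valid
  soundness (∧L d) = ∧L-valid (soundness d)
  soundness (∧R d₁ d₂) = ∧R-valid (soundness d₁) (soundness d₂)
  soundness (¬L d) = ¬L-valid (soundness d)
  soundness (¬R d) = ¬R-valid (soundness d)
  soundness (∀L {φ = φ} {a} {r} d) =
    ⋀-greatest (λ { _ (here refl) → ⋀-lb (here refl) ⟨≤⟩ forall-instance a φ r
                  ; _ (there x∈) → ⋀-lb (there x∈) })
    ⟨≤⟩ soundness d
  soundness (∀R {Ψ = Ψ} {ψ} {a} a∉Φ a∉Ψ d) =
    ∀R-valid (∉fv⇒#-⋀ a∉Φ) (∉fv⇒#-⋁ a∉Ψ) (soundness d)
    ⟨≤⟩ ≡⇒≤ (cong (λ z → ⋁ (z ∷ ⟦ Ψ ⟧s)) (sym (forall-denotation a ψ)))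
  soundness (=R {r = r} d) =
    ⋀-greatest (λ { _ (here refl) → ≤-⊤ ⟨≤⟩ ≡⇒≤ (sym (eqL-refl (⟦ r ⟧t V.[])))
                  ; _ (there x∈) → ⋀-lb x∈ })
    ⟨≤⟩ soundness d
  soundness (=L {φ = φ} {a} {r} {r'} d) =
    ⋀-greatest (λ { _ (here refl) → ⋀-lb (here refl)
                  ; _ (there (here refl)) →
                      ∧-greatest (⋀-lb (here refl)) (⋀-lb (there (here refl))) ⟨≤⟩ leibniz φ a r r'
                  ; _ (there (there x∈)) → ⋀-lb (there (there x∈)) })
    ⟨≤⟩ soundness d

theorem5p17 : (T : Termlike) (𝓛 : FOLeq T) (S : Signature)
              (I : Interpretation T 𝓛 S)
              (Φ Ψ : List (Syntax.Form S 0)) →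
              Syntax._⊢_ S Φ Ψ →
              FOLeq._≤_ 𝓛 (FOLeq.meet# 𝓛 [] (map (Semantics.⟦_⟧ I) Φ))
                          (FOLeq.join# 𝓛 [] (map (Semantics.⟦_⟧ I) Ψ))
theorem5p17 T 𝓛 S I Φ Ψ derivation = Soundness.soundness T 𝓛 S I derivation
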